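{- Let $n\ge 1$. The map $T:\Omega^0_n\times\{0,\dots,n\}\to\Omega^0_n$ defined below is the first component of a bijection $\bar T$ from $\Omega^0_n\times\{0,\dots,n\}$ onto itself; that is, there exists a bijection $\bar T:\Omega^0_n\times\{0,\dots,n\}\to\Omega^0_n\times\{0,\dots,n\}$ and a map $J$ with $\bar T(\omega,i)=(T(\omega,i),J(\omega,i))$ for all $(\omega,i)$.
   Context: A complete configuration of length $n$ is a pair of rows (top and bottom) of $n$ cells each, each cell containing a black ($\bullet$) or a white ($\circ$) particle, such that (i) the two rows together contain $n$ black and $n$ white particles, and (ii) for every $j\in\{0,\dots,n\}$ the first $j$ columns contain at least as many black as white particles. $\Omega^0_n$ is the set of these. Columns are numbered $1,\dots,n$ from left to right; walls are numbered $0,\dots,n$, wall $i$ lying between columns $i$ and $i+1$ (wall $0$ is the left border, wall $n$ the right border). Write $t_c,b_c$ for the top and bottom particles of column $c$. For $\omega\in\Omega^0_n$ and $i\in\{0,\dots,n\}$, $T(\omega,i)$ is defined by cases (in every case the particles not mentioned keep their relative order in their row): (a') If $1\le i\le n-1$, $t_i=\bullet$, $t_{i+1}=\circ$, $b_{i+1}=\bullet$: let $j_1$ be the smallest $j\in\{0,\dots,i-1\}$ such that $t_{j+1},\dots,t_{i-1}$ are all white; $T(\omega,i)$ is obtained by removing column $i+1$ and reinserting it so that it becomes column $j_1+1$. (a'') If $1\le i\le n-1$, $t_i=\bullet$, $t_{i+1}=\circ$, $b_{i+1}=\circ$: let $j_2$ be the largest $j\in\{i+1,\dots,n\}$ such that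 $t_{i+2},\dots,t_j$ are all black; the top row of $T(\omega,i)$ is obtained by deleting $t_i$ and inserting a black particle so that it becomes top cell $j_2$; the bottom row is obtained by deleting $b_{i+1}$ and inserting a white particle so that it becomes bottom cell $j_2+1$ if $j_2<n$, and bottom cell $n$ if $j_2=n$. (b) If $i=0$ and $t_1=\circ$ (then $b_1=\bullet$): let $j_2$ be the largest $j\in\{1,\dots,n\}$ such that $t_2,\dots,t_j$ are all black; delete column $1$, then insert a black particle in the top row so that it becomes top cell $j_2$, and a white particle in the bottom row so that it becomes bottom cell $j_2+1$ if $j_2<n$, bottom cell $n$ if $j_2=n$. (c) If $i=n$ and $t_n=\bullet$ (then $b_n=\circ$): let $j_1$ be the smallest $j\in\{0,\dots,n-1\}$ such that $t_{j+1},\dots,t_{n-1}$ are all white; delete column $n$ and insert a column with $\circ$ on top and $\bullet$ below so that it becomes column $j_1+1$. (d) Otherwise $T(\omega,i)=\omega$. -}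

module Defs where

open import Data.Bool using (Bool; true; false; _∧_; if_then_else_; T)
open import Data.Nat using (ℕ; zero; suc; _+_; _∸_; _≤ᵇ_; _<ᵇ_; _≡ᵇ_)
open import Data.List using (List; []; _∷_; _++_; take; drop; length; upTo; map; reverse)
open import Data.Product using (Σ; _×_; _,_; proj₁; proj₂)
open import Data.Fin using (Fin; toℕ)
open import Relation.Nullary using (Dec; yes; no)

data Particle : Set where
  black white : Particle

isBlack : Particle → Bool
isBlack black = true
isBlack white = false

isWhite : Particle → Bool
isWhite black = false
isWhite white = true

allᵇ : {A : Set} → (A → Bool) → List A → Bool
allᵇ p []       = true
allᵇ p (x ∷ xs) = p x ∧ allᵇ p xs

#black : List Particle → ℕ
#black []       = 0
#black (p ∷ ps) = (if isBlack p then 1 else 0) + #black ps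

#white : List Particle → ℕ
#white []       = 0
#white (p ∷ ps) = (if isWhite p then 1 else 0) + #white ps

-- A pair of rows (top , bottom); cells are numbered from 1.
Rows : Set
Rows = List Particle × List Particle

isComplete : ℕ → Rows → Bool
isComplete n (t , b) =
  (length t ≡ᵇ n) ∧ (length b ≡ᵇ n) ∧
  (#black (t ++ b) ≡ᵇ n) ∧ (#white (t ++ b) ≡ᵇ n) ∧
  allᵇ (λ j → #white (take j t ++ take j b) ≤ᵇ #black (take j t ++ take j b)) (upTo (suc n))

Ω⁰ : ℕ → Set
Ω⁰ n = Σ Rows (λ r → T (isComplete n r))

-- cell c (1-based) of a row; (out-of-range cells are never consulted by T
-- on the relevant cases; default white)
cell : List Particle → ℕ → Particle
cell []       _             = white
cell (p ∷ ps) zero          = white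
cell (p ∷ ps) (suc zero)    = p
cell (p ∷ ps) (suc (suc c)) = cell ps (suc c)

deleteAt : ℕ → List Particle → List Particle
deleteAt k xs = take (k ∸ 1) xs ++ drop k xs

insertAt : ℕ → Particle → List Particle → List Particle
insertAt k x xs = take (k ∸ 1) xs ++ x ∷ drop (k ∸ 1) xs

range : ℕ → ℕ → List ℕ
range a b = map (a +_) (upTo (suc b ∸ a))

allWhiteIn : List Particle → ℕ → ℕ → Bool
allWhiteIn t a b = allᵇ (λ c → isWhite (cell t c)) (range a b)

allBlackIn : List Particle → ℕ → ℕ → Bool
allBlackIn t a b = allᵇ (λ c → isBlack (cell t c)) (range a b)

headOr : ℕ → List ℕ → ℕ
headOr d []      = d
headOr d (x ∷ _) = x

lastOr : ℕ → List ℕ → ℕ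
lastOr d xs = headOr d (reverse xs)

filterᵇ : (ℕ → Bool) → List ℕ → List ℕ
filterᵇ p []       = []
filterᵇ p (x ∷ xs) = if p x then x ∷ filterᵇ p xs else filterᵇ p xs

-- j₁ : smallest j ∈ {0,…,i-1} such that t_{j+1},…,t_{i-1} are all white
-- (the set always contains i-1).
j₁ : List Particle → ℕ → ℕ
j₁ t i = headOr (i ∸ 1) (filterᵇ (λ j → allWhiteIn t (suc j) (i ∸ 1)) (range 0 (i ∸ 1)))

-- j₂ : largest j ∈ {i+1,…,n} such that t_{i+2},…,t_j are all black
-- (the set always contains i+1).
j₂ : ℕ → List Particle → ℕ → ℕ
j₂ n t i = lastOr (suc i) (filterᵇ (λ j → allBlackIn t (suc (suc i)) j) (range (suc i) n))

bottomPos : ℕ → ℕ → ℕ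
bottomPos n j = if j <ᵇ n then suc j else n

Tcase-a : ℕ → Rows → ℕ → Particle → Particle → Particle → Rows
-- (a') t_i = •, t_{i+1} = ∘, b_{i+1} = • : move column i+1 to become column j₁+1
Tcase-a n (t , b) i black white black =
  let k = j₁ t i in
  ( insertAt (suc k) (cell t (suc i)) (deleteAt (suc i) t)
  , insertAt (suc k) (cell b (suc i)) (deleteAt (suc i) b) )
-- (a'') t_i = •, t_{i+1} = ∘, b_{i+1} = ∘
Tcase-a n (t , b) i black white white =
  let k = j₂ n t i in
  ( insertAt k black (deleteAt i t)
  , insertAt (bottomPos n k) white (deleteAt (suc i) b) )
Tcase-a n r i _ _ _ = r

Traw : ℕ → Rows → ℕ → Rows
Traw n (t , b) zero with cell t 1
... | white =
  let k = j₂ n t 0 in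
  ( insertAt k black (deleteAt 1 t)
  , insertAt (bottomPos n k) white (deleteAt 1 b) )
... | black = (t , b)
Traw n (t , b) (suc i') with suc i' <ᵇ n
... | true  = Tcase-a n (t , b) (suc i') (cell t (suc i')) (cell t (suc (suc i'))) (cell b (suc (suc i')))
-- i ≥ n (i.e. i = n, since i ∈ {0,…,n}) : case (c) if t_n = •, otherwise (d)
... | false with cell t n
...   | black =
  let k = j₁ t n in
  ( insertAt (suc k) white (deleteAt n t)
  , insertAt (suc k) black (deleteAt n b) )
...   | white = (t , b)

rows : {n : ℕ} → Ω⁰ n → Rows
rows = proj₁

Tmap : (n : ℕ) → Ω⁰ n → Fin (suc n) → Rows
Tmap n ω i = Traw n (rows ω) (toℕ i)

module Submission where

-- The two rows of a configuration are read column by column as a lattice path: (•,•) is an up step,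
-- (∘,∘) a down step and a mixed column is flat, so Ω⁰ₙ consists of the paths from height 0 back to
-- 0 that never go below 0. Every non-trivial case of T is a local surgery on this path: (a′) and
-- (c) move a flat column; (a″) and (b) contract (•,x)(∘,∘) into (∘,x), resp. delete the flat column
-- (∘,•), just before a run of blacks, and compensate after the run by turning the next column (∘,y)
-- into (•,y)(∘,∘), or by appending (•,∘) if the run reaches the right border. Hence T(ω,i) ∈ Ω⁰ₙ.
-- Let J(ω,i) be the wall next to which the moved particles are reinserted (j₁ or j₂), and J = i in
-- case (d). From T(ω,i) and J alone one can tell which case occurred and undo it, so (ω,i) ↦
-- (T(ω,i), J(ω,i)) is injective, hence a bijection of the finite set Ω⁰ₙ × {0,…,n}.

open import Defs
open import Data.Bool using (Bool; true; false; _∧_; if_then_else_; T; T?)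
open import Data.Bool.Properties using (T-∧; T-≡; T-irrelevant)
open import Data.Nat
open import Data.Nat.Properties
open import Data.Nat.Tactic.RingSolver using (solve-∀)
open import Data.Fin using (Fin; zero; suc; toℕ; fromℕ<; punchOut)
open import Data.Fin.Properties using (any?; punchOut-injective; injective⇒≤; toℕ<n; toℕ-fromℕ<; toℕ-injective)
  renaming (_≟_ to _≟ᶠ_)
open import Data.List
  using (List; []; _∷_; _++_; take; drop; length; upTo; applyUpTo; map; reverse; replicate; spanᵇ;
         lookup; deduplicate; cartesianProduct; allFin)
open import Data.List.Properties
  using (≡-dec; length-++; length-++-sucʳ; length-replicate; ++-assoc; ++-identityʳ; map-applyUpTo; reverse-++)
open import Data.List.Membership.Propositional using (_∈_)
open import Data.List.Membership.Propositional.Properties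
  using (∈-upTo⁺; ∈-upTo⁻; ∈-++⁺ˡ; ∈-++⁺ʳ; ∈-map⁺; ∈-lookup; ∈-deduplicate⁺; ∈-cartesianProduct⁺; ∈-allFin)
open import Data.List.Relation.Unary.All as All using ()
open import Data.List.Relation.Unary.AllPairs using ([]; _∷_)
open import Data.List.Relation.Unary.Any using (here; there; index)
open import Data.List.Relation.Unary.Any.Properties using (lookup-index)
open import Data.List.Relation.Unary.Unique.Propositional using (Unique)
open import Data.List.Relation.Unary.Unique.DecPropositional.Properties using (deduplicate-!)
open import Data.Product using (Σ; ∃; ∃₂; _×_; _,_; proj₁; proj₂)
open import Data.Product.Properties using () renaming (≡-dec to ×-≡-dec)
open import Data.Sum using (inj₁; inj₂)
open import Function using (id; _∘_; case_of_)
open import Function.Bundles using (Equivalence; _⤖_; Bijection; mk⤖)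
open import Function.Definitions using (Injective; Surjective)
open import Relation.Binary.Definitions using (DecidableEquality)
open import Relation.Binary.PropositionalEquality
open import Relation.Nullary using (¬_; contradiction; yes; no)

open Equivalence using (to; from)

-- Lattice paths

-- Path h t b h': the columns of (t , b) form a path from height h to height h' that stays ≥ 0,
-- the height being half the excess of blacks over whites.
data Path : ℕ → List Particle → List Particle → ℕ → Set where
  []      : ∀ {h} → Path h [] [] h
  up      : ∀ {h t b h'} → Path (suc h) t b h' → Path h (black ∷ t) (black ∷ b) h'
  flat-bw : ∀ {h t b h'} → Path h t b h' → Path h (black ∷ t) (white ∷ b) h'
  flat-wb : ∀ {h t b h'} → Path h t b h' → Path h (white ∷ t) (black ∷ b) h'
  down    : ∀ {h t b h'} → Path h t b h' → Path (suc h) (white ∷ t) (white ∷ b) h'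

Complete : ℕ → Rows → Set
Complete n (t , b) = length t ≡ n × length b ≡ n × Path 0 t b 0

#black-middle : ∀ t y b → #black (t ++ y ∷ b) ≡ #black (y ∷ []) + #black (t ++ b)
#black-middle []      black b = refl
#black-middle []      white b = refl
#black-middle (x ∷ t) black b = trans (cong ((if isBlack x then 1 else 0) +_) (#black-middle t black b)) (+-suc _ _)
#black-middle (x ∷ t) white b = cong ((if isBlack x then 1 else 0) +_) (#black-middle t white b)

#white-middle : ∀ t y b → #white (t ++ y ∷ b) ≡ #white (y ∷ []) + #white (t ++ b)
#white-middle []      black b = refl
#white-middle []      white b = refl
#white-middle (x ∷ t) black b = cong ((if isWhite x then 1 else 0) +_) (#white-middle t black b)
#white-middle (x ∷ t) white b = trans (cong ((if isWhite x then 1 else 0) +_) (#white-middle t white b)) (+-suc _ _)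

#black+#white : ∀ xs → #black xs + #white xs ≡ length xs
#black+#white []           = refl
#black+#white (black ∷ xs) = cong suc (#black+#white xs)
#black+#white (white ∷ xs) = trans (+-suc (#black xs) (#white xs)) (cong suc (#black+#white xs))

private
  double-suc : ∀ x h → 2 + x + (h + h) ≡ x + (suc h + suc h)
  double-suc = solve-∀

Path-balance : ∀ {h t b h'} → Path h t b h' → #black (t ++ b) + (h + h) ≡ #white (t ++ b) + (h' + h')
Path-balance [] = refl
Path-balance (up {h} {t = t} {b} p)
  rewrite #black-middle t black b | #white-middle t black b
  = trans (double-suc (#black (t ++ b)) h) (Path-balance p)
Path-balance (flat-bw {t = t} {b} p)
  rewrite #black-middle t white b | #white-middle t white b
  = cong suc (Path-balance p)
Path-balance (flat-wb {t = t} {b} p)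
  rewrite #black-middle t black b | #white-middle t black b
  = cong suc (Path-balance p)
Path-balance (down {h} {t = t} {b} p)
  rewrite #black-middle t white b | #white-middle t white b
  = trans (sym (double-suc (#black (t ++ b)) h)) (cong (2 +_) (Path-balance p))

Dominated : ℕ → ℕ → List Particle → List Particle → Set
Dominated w d t b = ∀ j → j ≤ length t → #white (take j t ++ take j b) + w ≤ #black (take j t ++ take j b) + d

private
  regroup : ∀ a c W w → a + ((c + 0) + W) + w ≡ W + ((a + (c + 0)) + w)
  regroup = solve-∀

prefix-#white : ∀ x y t b j w →
  #white (take (suc j) (x ∷ t) ++ take (suc j) (y ∷ b)) + w ≡ #white (take j t ++ take j b) + (#white (x ∷ y ∷ []) + w)
prefix-#white x y t b j w =
  trans (cong (λ z → (if isWhite x then 1 else 0) + z + w) (#white-middle (take j t) y (take j b)))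
        (regroup (if isWhite x then 1 else 0) (if isWhite y then 1 else 0) (#white (take j t ++ take j b)) w)

prefix-#black : ∀ x y t b j d →
  #black (take (suc j) (x ∷ t) ++ take (suc j) (y ∷ b)) + d ≡ #black (take j t ++ take j b) + (#black (x ∷ y ∷ []) + d)
prefix-#black x y t b j d =
  trans (cong (λ z → (if isBlack x then 1 else 0) + z + d) (#black-middle (take j t) y (take j b)))
        (regroup (if isBlack x then 1 else 0) (if isBlack y then 1 else 0) (#black (take j t ++ take j b)) d)

Dominated-∷⁻ : ∀ {w d x y t b} → Dominated w d (x ∷ t) (y ∷ b) →
  w ≤ d × Dominated (#white (x ∷ y ∷ []) + w) (#black (x ∷ y ∷ []) + d) t b
Dominated-∷⁻ {w} {d} {x} {y} {t} {b} dom =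
  dom 0 z≤n , λ j j≤ → subst₂ _≤_ (prefix-#white x y t b j w) (prefix-#black x y t b j d) (dom (suc j) (s≤s j≤))

Dominated-∷⁺ : ∀ {w d x y t b} → w ≤ d → Dominated (#white (x ∷ y ∷ []) + w) (#black (x ∷ y ∷ []) + d) t b →
  Dominated w d (x ∷ t) (y ∷ b)
Dominated-∷⁺ w≤d dom zero    _         = w≤d
Dominated-∷⁺ {w} {d} {x} {y} {t} {b} w≤d dom (suc j) (s≤s j≤) =
  subst₂ _≤_ (sym (prefix-#white x y t b j w)) (sym (prefix-#black x y t b j d)) (dom j j≤)

private
  up-offset : ∀ h w → suc (suc (h + h + w)) ≡ suc h + suc h + w
  up-offset = solve-∀

  flat-offset : ∀ h w → h + h + suc w ≡ suc (h + h + w)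
  flat-offset h w = +-suc (h + h) w

  down-offset : ∀ h w → h + h + suc (suc w) ≡ suc h + suc h + w
  down-offset = solve-∀

Path⇒Dominated : ∀ {h t b h'} w → Path h t b h' → Dominated w (h + h + w) t b
Path⇒Dominated {h} w [] zero _ = m≤n+m w (h + h)
Path⇒Dominated {h} w (up {t = t} {b} p) =
  Dominated-∷⁺ (m≤n+m w (h + h)) (subst (λ d → Dominated w d t b) (sym (up-offset h w)) (Path⇒Dominated w p))
Path⇒Dominated {h} w (flat-bw {t = t} {b} p) =
  Dominated-∷⁺ (m≤n+m w (h + h)) (subst (λ d → Dominated (suc w) d t b) (flat-offset h w) (Path⇒Dominated (suc w) p))
Path⇒Dominated {h} w (flat-wb {t = t} {b} p) =
  Dominated-∷⁺ (m≤n+m w (h + h)) (subst (λ d → Dominated (suc w) d t b) (flat-offset h w) (Path⇒Dominated (suc w) p))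
Path⇒Dominated {suc h} w (down {t = t} {b} p) =
  Dominated-∷⁺ (m≤n+m w (suc h + suc h)) (subst (λ d → Dominated (2 + w) d t b) (down-offset h w) (Path⇒Dominated (2 + w) p))

Dominated⇒Path : ∀ {h t b} w → length t ≡ length b → Dominated w (h + h + w) t b → ∃ (Path h t b)
Dominated⇒Path {h} {[]} {[]} w _ _ = h , []
Dominated⇒Path {h} {x ∷ t} {y ∷ b} w len dom = step x y (proj₂ (Dominated-∷⁻ dom))
  where
  rest : ∀ {h'} w' → Dominated w' (h' + h' + w') t b → ∃ (Path h' t b)
  rest w' = Dominated⇒Path w' (suc-injective len)
  step : ∀ x y → Dominated (#white (x ∷ y ∷ []) + w) (#black (x ∷ y ∷ []) + (h + h + w)) t b → ∃ (Path h (x ∷ t) (y ∷ b))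
  step black black dom' = _ , up (proj₂ (rest w (subst (λ d → Dominated w d t b) (up-offset h w) dom')))
  step black white dom' = _ , flat-bw (proj₂ (rest (suc w) (subst (λ d → Dominated (suc w) d t b) (sym (flat-offset h w)) dom')))
  step white black dom' = _ , flat-wb (proj₂ (rest (suc w) (subst (λ d → Dominated (suc w) d t b) (sym (flat-offset h w)) dom')))
  step white white dom' = down-step h dom'
    where
    down-step : ∀ h → Dominated (2 + w) (h + h + w) t b → ∃ (Path h (white ∷ t) (white ∷ b))
    down-step zero    dom' = contradiction (dom' 0 z≤n) (m+n≮n 1 w)
    down-step (suc h) dom' = _ , down (proj₂ (rest (2 + w) (subst (λ d → Dominated (2 + w) d t b) (sym (down-offset h w)) dom')))

allᵇ-true⁻ : ∀ {A : Set} {p : A → Bool} {xs x} → allᵇ p xs ≡ true → x ∈ xs → p x ≡ true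
allᵇ-true⁻ {p = p} {y ∷ _} all (here refl) with p y
... | true = refl
allᵇ-true⁻ {p = p} {y ∷ _} all (there x∈) with p y
... | true = allᵇ-true⁻ all x∈

allᵇ-true⁺ : ∀ {A : Set} {p : A → Bool} xs → (∀ {x} → x ∈ xs → p x ≡ true) → allᵇ p xs ≡ true
allᵇ-true⁺ []       _   = refl
allᵇ-true⁺ (x ∷ xs) all rewrite all (here refl) = allᵇ-true⁺ xs (λ x∈ → all (there x∈))

allᵇ-false⁺ : ∀ {A : Set} {p : A → Bool} {xs x} → x ∈ xs → p x ≡ false → allᵇ p xs ≡ false
allᵇ-false⁺ {p = p} {y ∷ _} (here refl) px rewrite px = refl
allᵇ-false⁺ {p = p} {y ∷ _} (there x∈) px with p y
... | true  = allᵇ-false⁺ x∈ px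
... | false = refl

m+m≡n+n⇒m≡n : ∀ m n → m + m ≡ n + n → m ≡ n
m+m≡n+n⇒m≡n zero    zero    _ = refl
m+m≡n+n⇒m≡n (suc m) (suc n) e =
  cong suc (m+m≡n+n⇒m≡n m n (suc-injective (trans (sym (+-suc m m)) (trans (suc-injective e) (+-suc n n)))))

prefix-ok : List Particle → List Particle → ℕ → Bool
prefix-ok t b j = #white (take j t ++ take j b) ≤ᵇ #black (take j t ++ take j b)

isComplete⇒Complete : ∀ n r → T (isComplete n r) → Complete n r
isComplete⇒Complete n (t , b) c
  with lt , c ← to T-∧ c
  with lb , c ← to T-∧ c
  with nb , c ← to T-∧ c
  with nw , prefixes ← to T-∧ c
  = len-t , len-b , subst (Path 0 t b) (m+n≡0⇒m≡0 h (sym balance)) path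
  where
  len-t = ≡ᵇ⇒≡ _ _ lt
  len-b = ≡ᵇ⇒≡ _ _ lb
  dominated : Dominated 0 0 t b
  dominated j j≤ = subst₂ _≤_ (sym (+-identityʳ _)) (sym (+-identityʳ _))
    (≤ᵇ⇒≤ _ _ (from T-≡ (allᵇ-true⁻ {p = prefix-ok t b} (to T-≡ prefixes) (∈-upTo⁺ (s≤s (subst (j ≤_) len-t j≤))))))
  h = proj₁ (Dominated⇒Path 0 (trans len-t (sym len-b)) dominated)
  path = proj₂ (Dominated⇒Path 0 (trans len-t (sym len-b)) dominated)
  balance : 0 ≡ h + h
  balance = +-cancelˡ-≡ n 0 (h + h) (begin
    n + 0                     ≡⟨ cong (_+ 0) (sym (≡ᵇ⇒≡ (#black (t ++ b)) n nb)) ⟩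
    #black (t ++ b) + 0       ≡⟨ Path-balance path ⟩
    #white (t ++ b) + (h + h) ≡⟨ cong (_+ (h + h)) (≡ᵇ⇒≡ (#white (t ++ b)) n nw) ⟩
    n + (h + h)               ∎)
    where open ≡-Reasoning

Complete⇒isComplete : ∀ n r → Complete n r → T (isComplete n r)
Complete⇒isComplete n (t , b) (len-t , len-b , path) =
  from T-∧ (≡⇒≡ᵇ _ _ len-t , from T-∧ (≡⇒≡ᵇ _ _ len-b ,
    from T-∧ (≡⇒≡ᵇ _ _ #black≡n , from T-∧ (≡⇒≡ᵇ _ _ (trans (sym #black≡#white) #black≡n) , prefixes))))
  where
  #black≡#white : #black (t ++ b) ≡ #white (t ++ b)
  #black≡#white = +-cancelʳ-≡ 0 _ _ (Path-balance path)
  #black≡n : #black (t ++ b) ≡ n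
  #black≡n = m+m≡n+n⇒m≡n _ n (begin
    #black (t ++ b) + #black (t ++ b) ≡⟨ cong (#black (t ++ b) +_) #black≡#white ⟩
    #black (t ++ b) + #white (t ++ b) ≡⟨ #black+#white (t ++ b) ⟩
    length (t ++ b)                   ≡⟨ length-++ t ⟩
    length t + length b               ≡⟨ cong₂ _+_ len-t len-b ⟩
    n + n                             ∎)
    where open ≡-Reasoning
  prefixes : T (allᵇ (prefix-ok t b) (upTo (suc n)))
  prefixes = from T-≡ (allᵇ-true⁺ (upTo (suc n)) λ {j} j∈ → to T-≡ (≤⇒≤ᵇ (subst₂ _≤_ (+-identityʳ _) (+-identityʳ _)
    (Path⇒Dominated 0 path j (subst (j ≤_) (sym len-t) (s≤s⁻¹ (∈-upTo⁻ j∈)))))))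

interval : ℕ → ℕ → List ℕ
interval a zero    = []
interval a (suc k) = a ∷ interval (suc a) k

applyUpTo≡interval : ∀ (f : ℕ → ℕ) a k → (∀ x → f x ≡ a + x) → applyUpTo f k ≡ interval a k
applyUpTo≡interval f a zero    _ = refl
applyUpTo≡interval f a (suc k) f≗ =
  cong₂ _∷_ (trans (f≗ 0) (+-identityʳ a))
            (applyUpTo≡interval (λ x → f (suc x)) (suc a) k (λ x → trans (f≗ (suc x)) (+-suc a x)))

range≡interval : ∀ a b → range a b ≡ interval a (suc b ∸ a)
range≡interval a b = trans (map-applyUpTo (λ x → x) (a +_) (suc b ∸ a)) (applyUpTo≡interval (a +_) a _ (λ _ → refl))

interval-++ : ∀ a k l → interval a (k + l) ≡ interval a k ++ interval (a + k) l
interval-++ a zero    l = cong (λ a' → interval a' l) (sym (+-identityʳ a))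
interval-++ a (suc k) l =
  cong (a ∷_) (trans (interval-++ (suc a) k l) (cong (λ a' → interval (suc a) k ++ interval a' l) (sym (+-suc a k))))

∈-interval⁻ : ∀ {a k c} → c ∈ interval a k → a ≤ c × c < a + k
∈-interval⁻ {a} {suc k} (here refl) = ≤-refl , subst (a <_) (sym (+-suc a k)) (s≤s (m≤m+n a k))
∈-interval⁻ {a} {suc k} {c} (there c∈) with ∈-interval⁻ c∈
... | a<c , c< = <⇒≤ a<c , subst (c <_) (sym (+-suc a k)) c<

∈-interval⁺ : ∀ {a k c} → a ≤ c → c < a + k → c ∈ interval a k
∈-interval⁺ {a} {zero}  a≤c c< = contradiction (≤-trans c< (≤-reflexive (+-identityʳ a))) (≤⇒≯ a≤c)
∈-interval⁺ {a} {suc k} {c} a≤c c< with m≤n⇒m<n∨m≡n a≤c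
... | inj₂ refl = here refl
... | inj₁ a<c  = there (∈-interval⁺ a<c (subst (c <_) (+-suc a k) c<))

∈-range⁻ : ∀ {a b c} → c ∈ range a b → a ≤ c × c ≤ b
∈-range⁻ {a} {b} {c} c∈ with ∈-interval⁻ (subst (c ∈_) (range≡interval a b) c∈)
... | a≤c , c< = a≤c , s≤s⁻¹ (subst (c <_) (m+[n∸m]≡n a≤1+b) c<)
  where
  a≤1+b : a ≤ suc b
  a≤1+b = <⇒≤ (m∸n≢0⇒n<m {suc b} {a} λ e →
    contradiction (subst (λ d → c < a + d) e c<) (≤⇒≯ (subst (_≤ c) (sym (+-identityʳ a)) a≤c)))

∈-range⁺ : ∀ {a b c} → a ≤ c → c ≤ b → c ∈ range a b
∈-range⁺ {a} {b} {c} a≤c c≤b = subst (c ∈_) (sym (range≡interval a b))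
  (∈-interval⁺ a≤c (subst (c <_) (sym (m+[n∸m]≡n (≤-trans a≤c (m≤n⇒m≤1+n c≤b)))) (s≤s c≤b)))

filterᵇ-++ : ∀ p xs ys → filterᵇ p (xs ++ ys) ≡ filterᵇ p xs ++ filterᵇ p ys
filterᵇ-++ p []       ys = refl
filterᵇ-++ p (x ∷ xs) ys with p x
... | true  = cong (x ∷_) (filterᵇ-++ p xs ys)
... | false = filterᵇ-++ p xs ys

filterᵇ-none : ∀ {p} xs → (∀ {x} → x ∈ xs → p x ≡ false) → filterᵇ p xs ≡ []
filterᵇ-none []       _    = refl
filterᵇ-none (x ∷ xs) none rewrite none (here refl) = filterᵇ-none xs (λ x∈ → none (there x∈))

filterᵇ-all : ∀ {p} xs → (∀ {x} → x ∈ xs → p x ≡ true) → filterᵇ p xs ≡ xs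
filterᵇ-all []       _   = refl
filterᵇ-all (x ∷ xs) all rewrite all (here refl) = cong (x ∷_) (filterᵇ-all xs (λ x∈ → all (there x∈)))

lastOr-interval : ∀ d a k → lastOr d (interval a (suc k)) ≡ a + k
lastOr-interval d a k = begin
  headOr d (reverse (interval a (suc k)))
    ≡⟨ cong (λ xs → headOr d (reverse xs)) (trans (cong (interval a) (+-comm 1 k)) (interval-++ a k 1)) ⟩
  headOr d (reverse (interval a k ++ a + k ∷ []))
    ≡⟨ cong (headOr d) (reverse-++ (interval a k) (a + k ∷ [])) ⟩
  a + k ∎
  where open ≡-Reasoning

headOr-filterᵇ-∷ : ∀ {p x} d xs → p x ≡ true → headOr d (filterᵇ p (x ∷ xs)) ≡ x
headOr-filterᵇ-∷ d xs px rewrite px = refl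

j₁-spec : ∀ t j k → (∀ c → j < c → c ≤ j + k → cell t c ≡ white) → (0 < j → cell t j ≡ black) →
  j₁ t (suc (j + k)) ≡ j
j₁-spec t j k run-white black-at-j = begin
  headOr (j + k) (filterᵇ q (range 0 (j + k)))
    ≡⟨ cong (λ xs → headOr (j + k) (filterᵇ q xs)) split ⟩
  headOr (j + k) (filterᵇ q (interval 0 j ++ j ∷ interval (suc j) k))
    ≡⟨ cong (headOr (j + k)) (filterᵇ-++ q (interval 0 j) _) ⟩
  headOr (j + k) (filterᵇ q (interval 0 j) ++ filterᵇ q (j ∷ interval (suc j) k))
    ≡⟨ cong (λ xs → headOr (j + k) (xs ++ filterᵇ q (j ∷ interval (suc j) k))) (filterᵇ-none (interval 0 j) before) ⟩
  headOr (j + k) (filterᵇ q (j ∷ interval (suc j) k))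
    ≡⟨ headOr-filterᵇ-∷ {p = q} (j + k) (interval (suc j) k) at ⟩
  j ∎
  where
  open ≡-Reasoning
  q : ℕ → Bool
  q c = allWhiteIn t (suc c) (j + k)
  split : range 0 (j + k) ≡ interval 0 j ++ j ∷ interval (suc j) k
  split = trans (range≡interval 0 (j + k)) (trans (cong (interval 0) (sym (+-suc j k))) (interval-++ 0 j (suc k)))
  before : ∀ {c} → c ∈ interval 0 j → q c ≡ false
  before c∈ with ∈-interval⁻ c∈
  ... | _ , c<j = allᵇ-false⁺ (∈-range⁺ c<j (m≤m+n j k)) (cong isWhite (black-at-j (≤-<-trans z≤n c<j)))
  at : q j ≡ true
  at = allᵇ-true⁺ (range (suc j) (j + k)) λ c∈ → cong isWhite (run-white _ (proj₁ (∈-range⁻ c∈)) (proj₂ (∈-range⁻ c∈)))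

j₂-spec : ∀ n t i m → suc i + m ≤ n → (∀ c → suc i < c → c ≤ suc i + m → cell t c ≡ black) →
  (suc i + m < n → cell t (suc (suc i + m)) ≡ white) → j₂ n t i ≡ suc i + m
j₂-spec n t i m run≤n run-black white-after = begin
  lastOr (suc i) (filterᵇ q (range (suc i) n))
    ≡⟨ cong (λ xs → lastOr (suc i) (filterᵇ q xs)) split ⟩
  lastOr (suc i) (filterᵇ q (interval (suc i) (suc m) ++ interval (suc i + suc m) l))
    ≡⟨ cong (lastOr (suc i)) (filterᵇ-++ q (interval (suc i) (suc m)) _) ⟩
  lastOr (suc i) (filterᵇ q (interval (suc i) (suc m)) ++ filterᵇ q (interval (suc i + suc m) l))
    ≡⟨ cong₂ (λ xs ys → lastOr (suc i) (xs ++ ys)) (filterᵇ-all _ inside) (filterᵇ-none _ outside) ⟩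
  lastOr (suc i) (interval (suc i) (suc m) ++ [])
    ≡⟨ cong (lastOr (suc i)) (++-identityʳ (interval (suc i) (suc m))) ⟩
  lastOr (suc i) (interval (suc i) (suc m))
    ≡⟨ lastOr-interval (suc i) (suc i) m ⟩
  suc i + m ∎
  where
  open ≡-Reasoning
  q : ℕ → Bool
  q c = allBlackIn t (suc (suc i)) c
  l = n ∸ (suc i + m)
  split : range (suc i) n ≡ interval (suc i) (suc m) ++ interval (suc i + suc m) l
  split = trans (range≡interval (suc i) n) (trans (cong (interval (suc i)) len) (interval-++ (suc i) (suc m) l))
    where
    len : n ∸ i ≡ suc m + l
    len = begin
      n ∸ i                   ≡⟨ cong (_∸ i) (sym (m+[n∸m]≡n run≤n)) ⟩
      (suc i + m + l) ∸ i     ≡⟨ cong (λ x → (x + l) ∸ i) (sym (+-suc i m)) ⟩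
      (i + suc m + l) ∸ i     ≡⟨ cong (_∸ i) (+-assoc i (suc m) l) ⟩
      (i + (suc m + l)) ∸ i   ≡⟨ m+n∸m≡n i (suc m + l) ⟩
      suc m + l               ∎
  inside : ∀ {c} → c ∈ interval (suc i) (suc m) → q c ≡ true
  inside {c} c∈ with ∈-interval⁻ c∈
  ... | _ , c< = allᵇ-true⁺ (range (suc (suc i)) c) λ c'∈ → let lo , hi = ∈-range⁻ {b = c} c'∈ in
    cong isBlack (run-black _ lo (≤-trans hi (s≤s⁻¹ (subst (c <_) (+-suc (suc i) m) c<))))
  outside : ∀ {c} → c ∈ interval (suc i + suc m) l → q c ≡ false
  outside {c} c∈ with ∈-interval⁻ c∈
  ... | run< , c< = allᵇ-false⁺ (∈-range⁺ {c = suc (suc i + m)} (s≤s (s≤s (m≤m+n i m))) run<c)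
    (cong isBlack (white-after (≤-trans run<c (s≤s⁻¹ c≤n))))
    where
    run<c : suc (suc i + m) ≤ c
    run<c = subst (_≤ c) (+-suc (suc i) m) run<
    c≤n : c < suc n
    c≤n = subst (c <_) (trans (cong (_+ l) (+-suc (suc i) m)) (cong suc (m+[n∸m]≡n run≤n))) c<


whites blacks : ℕ → List Particle
whites k = replicate k white
blacks m = replicate m black

data EndsInBlack : List Particle → Set where
  []   : EndsInBlack []
  snoc : ∀ p → EndsInBlack (p ++ black ∷ [])

private
  n≡n+0 : ∀ n → n ≡ n + 0
  n≡n+0 n = sym (+-identityʳ n)

  1+n≡n+1 : ∀ n → suc n ≡ n + 1
  1+n≡n+1 n = +-comm 1 n

  2+n≡n+2 : ∀ n → suc (suc n) ≡ n + 2
  2+n≡n+2 n = +-comm 2 n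

  aligned+0 : ∀ {a b} → a ≡ b → b ≡ a + 0
  aligned+0 refl = n≡n+0 _

  aligned+1 : ∀ {a b} → a ≡ b → suc b ≡ a + 1
  aligned+1 refl = 1+n≡n+1 _

  length-blacks+0 : ∀ m → m ≡ length (blacks m) + 0
  length-blacks+0 m = sym (trans (+-identityʳ _) (length-replicate m))

  length-whites+0 : ∀ k → k ≡ length (whites k) + 0
  length-whites+0 k = sym (trans (+-identityʳ _) (length-replicate k))

  length-whites+1 : ∀ k → suc k ≡ length (whites k) + 1
  length-whites+1 k = trans (1+n≡n+1 k) (cong (_+ 1) (sym (length-replicate k)))

module _ {A : Set} where

  take-length-++ : ∀ (xs : List A) {ys} → take (length xs) (xs ++ ys) ≡ xs
  take-length-++ []       = refl
  take-length-++ (x ∷ xs) = cong (x ∷_) (take-length-++ xs)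

  drop-++ : ∀ (xs : List A) {ys i c} → i ≡ length xs + c → drop i (xs ++ ys) ≡ drop c ys
  drop-++ []       refl = refl
  drop-++ (x ∷ xs) refl = drop-++ xs refl

  replicate-++-∷ : ∀ m (x : A) ys → replicate m x ++ x ∷ ys ≡ x ∷ replicate m x ++ ys
  replicate-++-∷ zero    x ys = refl
  replicate-++-∷ (suc m) x ys = cong (x ∷_) (replicate-++-∷ m x ys)

  replicate-∷ʳ : ∀ m (x : A) → replicate m x ++ x ∷ [] ≡ x ∷ replicate m x
  replicate-∷ʳ m x = trans (replicate-++-∷ m x []) (cong (x ∷_) (++-identityʳ _))

cell-++ : ∀ xs {ys i c} → i ≡ length xs + c → cell (xs ++ ys) (suc i) ≡ cell ys (suc c)
cell-++ []       refl = refl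
cell-++ (x ∷ xs) refl = cell-++ xs refl

deleteAt-++ : ∀ xs {ys i c} → i ≡ length xs + c → deleteAt (suc i) (xs ++ ys) ≡ xs ++ deleteAt (suc c) ys
deleteAt-++ []       refl = refl
deleteAt-++ (x ∷ xs) refl = cong (x ∷_) (deleteAt-++ xs refl)

insertAt-++ : ∀ xs {y ys i c} → i ≡ length xs + c → insertAt (suc i) y (xs ++ ys) ≡ xs ++ insertAt (suc c) y ys
insertAt-++ []       refl = refl
insertAt-++ (x ∷ xs) refl = cong (x ∷_) (insertAt-++ xs refl)

insertAt-end : ∀ xs {y i} → i ≡ length xs → insertAt (suc i) y xs ≡ xs ++ y ∷ []
insertAt-end []       refl = refl
insertAt-end (x ∷ xs) refl = cong (x ∷_) (insertAt-end xs refl)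

cell-replicate : ∀ xs k y ys c → length xs < c → c ≤ length xs + k → cell (xs ++ replicate k y ++ ys) c ≡ y
cell-replicate []       (suc k) y ys (suc zero)    _         _        = refl
cell-replicate []       (suc k) y ys (suc (suc c)) _         (s≤s c≤) = cell-replicate [] k y ys (suc c) (s≤s z≤n) c≤
cell-replicate (x ∷ xs) k       y ys (suc (suc c)) (s≤s xs<) (s≤s c≤) = cell-replicate xs k y ys (suc c) xs< c≤

cell-replicate-end : ∀ xs k y c → length xs < c → c ≤ length xs + k → cell (xs ++ replicate k y) c ≡ y
cell-replicate-end xs k y c lo hi = subst (λ l → cell (xs ++ l) c ≡ y) (++-identityʳ _) (cell-replicate xs k y [] c lo hi)

EndsInBlack-cell : ∀ {p} ys → EndsInBlack p → 0 < length p → cell (p ++ ys) (length p) ≡ black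
EndsInBlack-cell ys (snoc p) _ = begin
  cell ((p ++ black ∷ []) ++ ys) (length (p ++ black ∷ []))
    ≡⟨ cong₂ cell (++-assoc p (black ∷ []) ys) (trans (length-++ p) (+-comm (length p) 1)) ⟩
  cell (p ++ black ∷ ys) (suc (length p))
    ≡⟨ cell-++ p (n≡n+0 _) ⟩
  black ∎
  where open ≡-Reasoning

<ᵇ-irrefl : ∀ n → (n <ᵇ n) ≡ false
<ᵇ-irrefl zero    = refl
<ᵇ-irrefl (suc n) = <ᵇ-irrefl n

<⇒<ᵇ≡true : ∀ {m n} → m < n → (m <ᵇ n) ≡ true
<⇒<ᵇ≡true m<n = to T-≡ (<⇒<ᵇ m<n)

bottomPos-< : ∀ {n j} → j < n → bottomPos n j ≡ suc j
bottomPos-< j<n rewrite <⇒<ᵇ≡true j<n = refl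

bottomPos-n : ∀ n → bottomPos n n ≡ n
bottomPos-n n rewrite <ᵇ-irrefl n = refl

-- The cases of T

-- Move n (t , b) i (t' , b') j: case (a′), (a″), (b), (c) or (d) of the definition of T applies at
-- wall i of (t , b), T yields (t' , b'), and j is J: the wall j₁ after which the moved column is
-- reinserted, the wall j₂ before which the black is reinserted, or i itself. The -end variants are
-- those in which j₂ = n.
data Move (n : ℕ) : Rows → ℕ → Rows → ℕ → Set where
  move-a′     : ∀ p q u w y v → EndsInBlack p → length u ≡ length p → suc (length p + length w) < n →
                Move n (p ++ whites (length w) ++ black ∷ white ∷ q , u ++ w ++ y ∷ black ∷ v) (suc (length p + length w))
                       (p ++ white ∷ whites (length w) ++ black ∷ q , u ++ black ∷ w ++ y ∷ v) (length p)
  move-a″     : ∀ p r u x w y v → length u ≡ length p → suc (suc (length p + length w)) < n →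
                Move n (p ++ black ∷ white ∷ blacks (length w) ++ white ∷ r , u ++ x ∷ white ∷ w ++ y ∷ v) (suc (length p))
                       (p ++ white ∷ black ∷ blacks (length w) ++ white ∷ r , u ++ x ∷ w ++ y ∷ white ∷ v)
                       (suc (suc (length p + length w)))
  move-a″-end : ∀ p u x w → length u ≡ length p → suc (suc (length p + length w)) ≡ n →
                Move n (p ++ black ∷ white ∷ blacks (length w) , u ++ x ∷ white ∷ w) (suc (length p))
                       (p ++ white ∷ black ∷ blacks (length w) , u ++ x ∷ w ++ white ∷ []) n
  move-b      : ∀ r w y v → suc (length w) < n →
                Move n (white ∷ blacks (length w) ++ white ∷ r , black ∷ w ++ y ∷ v) 0
                       (black ∷ blacks (length w) ++ white ∷ r , w ++ y ∷ white ∷ v) (suc (length w))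
  move-b-end  : ∀ w → suc (length w) ≡ n →
                Move n (white ∷ blacks (length w) , black ∷ w) 0 (black ∷ blacks (length w) , w ++ white ∷ []) n
  move-c      : ∀ p u w → EndsInBlack p → length u ≡ length p → suc (length p + length w) ≡ n →
                Move n (p ++ whites (length w) ++ black ∷ [] , u ++ w ++ white ∷ []) n
                       (p ++ white ∷ whites (length w) , u ++ black ∷ w) (length p)
  fixed-0     : ∀ t b → cell t 1 ≡ black → Move n (t , b) 0 (t , b) 0
  fixed-n     : ∀ t b n' → suc n' ≡ n → cell t n ≡ white → Move n (t , b) n (t , b) n
  fixed       : ∀ t b i → suc i < n → ¬ (cell t (suc i) ≡ black × cell t (suc (suc i)) ≡ white) →
                Move n (t , b) (suc i) (t , b) (suc i)

Move-J≤n : ∀ {n r i r' j} → Move n r i r' j → j ≤ n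
Move-J≤n (move-a′ p q u w y v _ _ i<n)   = ≤-trans (m≤m+n (length p) (length w)) (≤-trans (n≤1+n _) (<⇒≤ i<n))
Move-J≤n (move-a″ p r u x w y v _ j<n)   = <⇒≤ j<n
Move-J≤n (move-a″-end p u x w _ refl)    = ≤-refl
Move-J≤n (move-b r w y v j<n)            = <⇒≤ j<n
Move-J≤n (move-b-end w refl)             = ≤-refl
Move-J≤n (move-c p u w _ _ refl)         = ≤-trans (m≤m+n (length p) (length w)) (n≤1+n _)
Move-J≤n (fixed-0 t b _)                 = z≤n
Move-J≤n (fixed-n t b n' _ _)            = ≤-refl
Move-J≤n (fixed t b i i<n _)             = <⇒≤ i<n

Traw-0 : ∀ {n t b} → cell t 1 ≡ white →
  Traw n (t , b) 0 ≡ (insertAt (j₂ n t 0) black (deleteAt 1 t) , insertAt (bottomPos n (j₂ n t 0)) white (deleteAt 1 b))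
Traw-0 t₁ rewrite t₁ = refl

Traw-inner : ∀ {n t b i} → suc i < n →
  Traw n (t , b) (suc i) ≡ Tcase-a n (t , b) (suc i) (cell t (suc i)) (cell t (suc (suc i))) (cell b (suc (suc i)))
Traw-inner i<n rewrite <⇒<ᵇ≡true i<n = refl

Traw-n : ∀ {n t b} → cell t (suc n) ≡ black →
  Traw (suc n) (t , b) (suc n) ≡
    (insertAt (suc (j₁ t (suc n))) white (deleteAt (suc n) t) , insertAt (suc (j₁ t (suc n))) black (deleteAt (suc n) b))
Traw-n {n} tₙ rewrite <ᵇ-irrefl n | tₙ = refl

Tcase-a-cells : ∀ {n r i x x' y y' z z'} → x ≡ x' → y ≡ y' → z ≡ z' → Tcase-a n r i x y z ≡ Tcase-a n r i x' y' z'
Tcase-a-cells refl refl refl = refl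

Tcase-a-fixed : ∀ {n r i} x y z → ¬ (x ≡ black × y ≡ white) → Tcase-a n r i x y z ≡ r
Tcase-a-fixed black white z not = contradiction (refl , refl) not
Tcase-a-fixed black black z not = refl
Tcase-a-fixed white y     z not = refl

T-a′ : ∀ {n} p q u w y v → EndsInBlack p → length u ≡ length p → suc (length p + length w) < n →
  Traw n (p ++ whites (length w) ++ black ∷ white ∷ q , u ++ w ++ y ∷ black ∷ v) (suc (length p + length w))
    ≡ (p ++ white ∷ whites (length w) ++ black ∷ q , u ++ black ∷ w ++ y ∷ v)
T-a′ {n} p q u w y v eb lu i<n =
  trans (Traw-inner {n} {t} {b} i<n) (trans (Tcase-a-cells tᵢ tᵢ₊₁ bᵢ₊₁) (cong₂ _,_ top bottom))
  where
  L = length p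
  k = length w
  t = p ++ whites k ++ black ∷ white ∷ q
  b = u ++ w ++ y ∷ black ∷ v
  i≡ : suc (L + k) ≡ length u + suc k
  i≡ = trans (sym (+-suc L k)) (cong (_+ suc k) (sym lu))
  tᵢ : cell t (suc (L + k)) ≡ black
  tᵢ = trans (cell-++ p refl) (cell-++ (whites k) (length-whites+0 k))
  tᵢ₊₁ : cell t (suc (suc (L + k))) ≡ white
  tᵢ₊₁ = trans (cell-++ p (sym (+-suc L k))) (cell-++ (whites k) (length-whites+1 k))
  bᵢ₊₁ : cell b (suc (suc (L + k))) ≡ black
  bᵢ₊₁ = trans (cell-++ u i≡) (cell-++ w (1+n≡n+1 k))
  j₁≡ : j₁ t (suc (L + k)) ≡ L
  j₁≡ = j₁-spec t L k (cell-replicate p k white (black ∷ white ∷ q)) (EndsInBlack-cell (whites k ++ black ∷ white ∷ q) eb)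
  top : insertAt (suc (j₁ t (suc (L + k)))) (cell t (suc (suc (L + k)))) (deleteAt (suc (suc (L + k))) t)
          ≡ p ++ white ∷ whites k ++ black ∷ q
  top = trans (cong₂ (λ j x → insertAt (suc j) x (deleteAt (suc (suc (L + k))) t)) j₁≡ tᵢ₊₁)
          (trans (cong (insertAt (suc L) white)
                   (trans (deleteAt-++ p (sym (+-suc L k))) (cong (p ++_) (deleteAt-++ (whites k) (length-whites+1 k)))))
            (insertAt-++ p (n≡n+0 L)))
  bottom : insertAt (suc (j₁ t (suc (L + k)))) (cell b (suc (suc (L + k)))) (deleteAt (suc (suc (L + k))) b)
             ≡ u ++ black ∷ w ++ y ∷ v
  bottom = trans (cong₂ (λ j x → insertAt (suc j) x (deleteAt (suc (suc (L + k))) b)) j₁≡ bᵢ₊₁)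
             (trans (cong (insertAt (suc L) black) (trans (deleteAt-++ u i≡) (cong (u ++_) (deleteAt-++ w (1+n≡n+1 k)))))
               (insertAt-++ u (aligned+0 lu)))

private
  blacks-after₂ : ∀ p x y m ys c → suc (suc (length p)) < c → c ≤ suc (suc (length p)) + m →
                  cell (p ++ x ∷ y ∷ replicate m black ++ ys) c ≡ black
  blacks-after₂ p x y m ys c lo hi =
    subst (λ t → cell t c ≡ black) (++-assoc p (x ∷ y ∷ []) _)
      (cell-replicate (p ++ x ∷ y ∷ []) m black ys c (subst (_< c) (sym len₂) lo) (subst (λ l → c ≤ l + m) (sym len₂) hi))
    where len₂ : length (p ++ x ∷ y ∷ []) ≡ suc (suc (length p))
          len₂ = trans (length-++ p) (+-comm (length p) 2)

  a″-index : ∀ L m → suc (suc (L + m)) ≡ L + suc (suc m)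
  a″-index L m = sym (trans (+-suc L (suc m)) (cong suc (+-suc L m)))

T-a″ : ∀ {n} p r u x w y v → length u ≡ length p → suc (suc (length p + length w)) < n →
  Traw n (p ++ black ∷ white ∷ blacks (length w) ++ white ∷ r , u ++ x ∷ white ∷ w ++ y ∷ v) (suc (length p))
    ≡ (p ++ white ∷ black ∷ blacks (length w) ++ white ∷ r , u ++ x ∷ w ++ y ∷ white ∷ v)
T-a″ {n} p r u x w y v lu j<n =
  trans (Traw-inner {n} {t} {b} (<-trans (s≤s (s≤s (m≤m+n L m))) j<n))
    (trans (Tcase-a-cells tᵢ tᵢ₊₁ bᵢ₊₁) (cong₂ _,_ top bottom))
  where
  L = length p
  m = length w
  t = p ++ black ∷ white ∷ blacks m ++ white ∷ r
  b = u ++ x ∷ white ∷ w ++ y ∷ v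
  tᵢ : cell t (suc L) ≡ black
  tᵢ = cell-++ p (n≡n+0 L)
  tᵢ₊₁ : cell t (suc (suc L)) ≡ white
  tᵢ₊₁ = cell-++ p (1+n≡n+1 L)
  bᵢ₊₁ : cell b (suc (suc L)) ≡ white
  bᵢ₊₁ = cell-++ u (aligned+1 lu)
  j₂≡ : j₂ n t (suc L) ≡ suc (suc (L + m))
  j₂≡ = j₂-spec n t (suc L) m (<⇒≤ j<n) (blacks-after₂ p black white m (white ∷ r))
          (λ _ → trans (cell-++ p (a″-index L m)) (cell-++ (blacks m) (length-blacks+0 m)))
  top : insertAt (j₂ n t (suc L)) black (deleteAt (suc L) t) ≡ p ++ white ∷ black ∷ blacks m ++ white ∷ r
  top = trans (cong₂ (λ j l → insertAt j black l) j₂≡ (deleteAt-++ p (n≡n+0 L)))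
          (trans (insertAt-++ p (sym (+-suc L m)))
            (cong (λ z → p ++ white ∷ z) (trans (insertAt-++ (blacks m) (length-blacks+0 m)) (replicate-++-∷ m black (white ∷ r)))))
  bottom : insertAt (bottomPos n (j₂ n t (suc L))) white (deleteAt (suc (suc L)) b) ≡ u ++ x ∷ w ++ y ∷ white ∷ v
  bottom = trans (cong₂ (λ j l → insertAt (bottomPos n j) white l) j₂≡ (deleteAt-++ u (aligned+1 lu)))
             (trans (cong (λ k → insertAt k white (u ++ x ∷ w ++ y ∷ v)) (bottomPos-< j<n))
               (trans (insertAt-++ u (trans (a″-index L m) (cong (_+ suc (suc m)) (sym lu))))
                 (cong (λ z → u ++ x ∷ z) (insertAt-++ w (1+n≡n+1 m)))))

T-a″-end : ∀ {n} p u x w → length u ≡ length p → suc (suc (length p + length w)) ≡ n →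
  Traw n (p ++ black ∷ white ∷ blacks (length w) , u ++ x ∷ white ∷ w) (suc (length p))
    ≡ (p ++ white ∷ black ∷ blacks (length w) , u ++ x ∷ w ++ white ∷ [])
T-a″-end {n} p u x w lu refl =
  trans (Traw-inner {n} {t} {b} (s≤s (s≤s (m≤m+n L m)))) (trans (Tcase-a-cells tᵢ tᵢ₊₁ bᵢ₊₁) (cong₂ _,_ top bottom))
  where
  L = length p
  m = length w
  t = p ++ black ∷ white ∷ blacks m
  b = u ++ x ∷ white ∷ w
  tᵢ : cell t (suc L) ≡ black
  tᵢ = cell-++ p (n≡n+0 L)
  tᵢ₊₁ : cell t (suc (suc L)) ≡ white
  tᵢ₊₁ = cell-++ p (1+n≡n+1 L)
  bᵢ₊₁ : cell b (suc (suc L)) ≡ white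
  bᵢ₊₁ = cell-++ u (aligned+1 lu)
  j₂≡ : j₂ n t (suc L) ≡ n
  j₂≡ = j₂-spec n t (suc L) m ≤-refl
          (λ c lo hi → subst (λ t → cell t c ≡ black) (cong (λ z → p ++ black ∷ white ∷ z) (++-identityʳ _))
                         (blacks-after₂ p black white m [] c lo hi))
          (λ n<n → contradiction n<n (n≮n n))
  top : insertAt (j₂ n t (suc L)) black (deleteAt (suc L) t) ≡ p ++ white ∷ black ∷ blacks m
  top = trans (cong₂ (λ j l → insertAt j black l) j₂≡ (deleteAt-++ p (n≡n+0 L)))
          (trans (insertAt-++ p (sym (+-suc L m)))
            (cong (λ z → p ++ white ∷ z) (trans (insertAt-end (blacks m) (sym (length-replicate m))) (replicate-∷ʳ m black))))
  bottom : insertAt (bottomPos n (j₂ n t (suc L))) white (deleteAt (suc (suc L)) b) ≡ u ++ x ∷ w ++ white ∷ []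
  bottom = trans (cong₂ (λ j l → insertAt (bottomPos n j) white l) j₂≡ (deleteAt-++ u (aligned+1 lu)))
             (trans (cong (λ k → insertAt k white (u ++ x ∷ w)) (bottomPos-n n))
               (trans (insertAt-++ u (trans (sym (+-suc L m)) (cong (_+ suc m) (sym lu))))
                 (cong (λ z → u ++ x ∷ z) (insertAt-end w refl))))

T-b : ∀ {n} r w y v → suc (length w) < n →
  Traw n (white ∷ blacks (length w) ++ white ∷ r , black ∷ w ++ y ∷ v) 0
    ≡ (black ∷ blacks (length w) ++ white ∷ r , w ++ y ∷ white ∷ v)
T-b {n} r w y v j<n = trans (Traw-0 {n} {t} {black ∷ w ++ y ∷ v} refl) (cong₂ _,_ top bottom)
  where
  m = length w
  t = white ∷ blacks m ++ white ∷ r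
  j₂≡ : j₂ n t 0 ≡ suc m
  j₂≡ = j₂-spec n t 0 m (<⇒≤ j<n) (cell-replicate (white ∷ []) m black (white ∷ r))
          (λ _ → cell-++ (white ∷ blacks m) (cong suc (length-blacks+0 m)))
  top : insertAt (j₂ n t 0) black (blacks m ++ white ∷ r) ≡ black ∷ blacks m ++ white ∷ r
  top = trans (cong (λ k → insertAt k black (blacks m ++ white ∷ r)) j₂≡)
          (trans (insertAt-++ (blacks m) (length-blacks+0 m)) (replicate-++-∷ m black (white ∷ r)))
  bottom : insertAt (bottomPos n (j₂ n t 0)) white (w ++ y ∷ v) ≡ w ++ y ∷ white ∷ v
  bottom = trans (cong (λ k → insertAt (bottomPos n k) white (w ++ y ∷ v)) j₂≡)
             (trans (cong (λ k → insertAt k white (w ++ y ∷ v)) (bottomPos-< j<n)) (insertAt-++ w (1+n≡n+1 m)))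

T-b-end : ∀ {n} w → suc (length w) ≡ n →
  Traw n (white ∷ blacks (length w) , black ∷ w) 0 ≡ (black ∷ blacks (length w) , w ++ white ∷ [])
T-b-end {n} w refl = trans (Traw-0 {n} {t} {black ∷ w} refl) (cong₂ _,_ top bottom)
  where
  m = length w
  t = white ∷ blacks m
  j₂≡ : j₂ n t 0 ≡ n
  j₂≡ = j₂-spec n t 0 m ≤-refl (cell-replicate-end (white ∷ []) m black) (λ n<n → contradiction n<n (n≮n n))
  top : insertAt (j₂ n t 0) black (blacks m) ≡ black ∷ blacks m
  top = trans (cong (λ k → insertAt k black (blacks m)) j₂≡)
          (trans (insertAt-end (blacks m) (sym (length-replicate m))) (replicate-∷ʳ m black))
  bottom : insertAt (bottomPos n (j₂ n t 0)) white w ≡ w ++ white ∷ []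
  bottom = trans (cong (λ k → insertAt (bottomPos n k) white w) j₂≡)
             (trans (cong (λ k → insertAt k white w) (bottomPos-n n)) (insertAt-end w refl))

T-c : ∀ {n} p u w → EndsInBlack p → length u ≡ length p → suc (length p + length w) ≡ n →
  Traw n (p ++ whites (length w) ++ black ∷ [] , u ++ w ++ white ∷ []) n ≡ (p ++ white ∷ whites (length w) , u ++ black ∷ w)
T-c p u w eb lu refl = trans (Traw-n {L + k} {t} {b} tₙ) (cong₂ _,_ top bottom)
  where
  L = length p
  k = length w
  t = p ++ whites k ++ black ∷ []
  b = u ++ w ++ white ∷ []
  tₙ : cell t (suc (L + k)) ≡ black
  tₙ = trans (cell-++ p refl) (cell-++ (whites k) (length-whites+0 k))
  j₁≡ : j₁ t (suc (L + k)) ≡ L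
  j₁≡ = j₁-spec t L k (cell-replicate p k white (black ∷ [])) (EndsInBlack-cell (whites k ++ black ∷ []) eb)
  top : insertAt (suc (j₁ t (suc (L + k)))) white (deleteAt (suc (L + k)) t) ≡ p ++ white ∷ whites k
  top = trans (cong₂ (λ j l → insertAt (suc j) white l) j₁≡
                 (trans (deleteAt-++ p refl) (cong (p ++_) (trans (deleteAt-++ (whites k) (length-whites+0 k)) (++-identityʳ _)))))
              (insertAt-++ p (n≡n+0 L))
  bottom : insertAt (suc (j₁ t (suc (L + k)))) black (deleteAt (suc (L + k)) b) ≡ u ++ black ∷ w
  bottom = trans (cong₂ (λ j l → insertAt (suc j) black l) j₁≡
                    (trans (deleteAt-++ u (cong (_+ k) (sym lu))) (cong (u ++_) (trans (deleteAt-++ w (n≡n+0 k)) (++-identityʳ w)))))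
                 (insertAt-++ u (aligned+0 lu))

Move⇒Traw : ∀ {n r i r' j} → Move n r i r' j → Traw n r i ≡ r'
Move⇒Traw (move-a′ p q u w y v eb lu i<n)  = T-a′ p q u w y v eb lu i<n
Move⇒Traw (move-a″ p r u x w y v lu j<n)   = T-a″ p r u x w y v lu j<n
Move⇒Traw (move-a″-end p u x w lu j≡n)     = T-a″-end p u x w lu j≡n
Move⇒Traw (move-b r w y v j<n)             = T-b r w y v j<n
Move⇒Traw (move-b-end w j≡n)               = T-b-end w j≡n
Move⇒Traw (move-c p u w eb lu n≡)          = T-c p u w eb lu n≡
Move⇒Traw (fixed-0 t b t₁) rewrite t₁      = refl
Move⇒Traw (fixed-n t b n' refl tₙ) rewrite <ᵇ-irrefl n' | tₙ = refl
Move⇒Traw {n} (fixed t b i i<n not)        = trans (Traw-inner {n} {t} {b} i<n) (Tcase-a-fixed _ _ _ not)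

Path-length : ∀ {h t b h'} → Path h t b h' → length t ≡ length b
Path-length []          = refl
Path-length (up p)      = cong suc (Path-length p)
Path-length (flat-bw p) = cong suc (Path-length p)
Path-length (flat-wb p) = cong suc (Path-length p)
Path-length (down p)    = cong suc (Path-length p)

Path-++⁺ : ∀ {h g h' xs ys xs' ys'} → Path h xs ys g → Path g xs' ys' h' → Path h (xs ++ xs') (ys ++ ys') h'
Path-++⁺ []          q = q
Path-++⁺ (up p)      q = up (Path-++⁺ p q)
Path-++⁺ (flat-bw p) q = flat-bw (Path-++⁺ p q)
Path-++⁺ (flat-wb p) q = flat-wb (Path-++⁺ p q)
Path-++⁺ (down p)    q = down (Path-++⁺ p q)

Path-++⁻ : ∀ xs ys {h h' xs' ys'} → length xs ≡ length ys → Path h (xs ++ xs') (ys ++ ys') h' →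
  ∃ λ g → Path h xs ys g × Path g xs' ys' h'
Path-++⁻ []       []       _   p           = _ , [] , p
Path-++⁻ (x ∷ xs) (y ∷ ys) len (up p)      = let g , p₁ , p₂ = Path-++⁻ xs ys (suc-injective len) p in g , up p₁ , p₂
Path-++⁻ (x ∷ xs) (y ∷ ys) len (flat-bw p) = let g , p₁ , p₂ = Path-++⁻ xs ys (suc-injective len) p in g , flat-bw p₁ , p₂
Path-++⁻ (x ∷ xs) (y ∷ ys) len (flat-wb p) = let g , p₁ , p₂ = Path-++⁻ xs ys (suc-injective len) p in g , flat-wb p₁ , p₂
Path-++⁻ (x ∷ xs) (y ∷ ys) len (down p)    = let g , p₁ , p₂ = Path-++⁻ xs ys (suc-injective len) p in g , down p₁ , p₂

Path-local : ∀ xs ys {h h' s c s' c'} → length xs ≡ length ys → (∀ {g} → Path g s c h' → Path g s' c' h') →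
  Path h (xs ++ s) (ys ++ c) h' → Path h (xs ++ s') (ys ++ c') h'
Path-local xs ys len f p = let _ , p₁ , p₂ = Path-++⁻ xs ys len p in Path-++⁺ p₁ (f p₂)

Path-unflat-wb : ∀ {g h s c} → Path g (white ∷ s) (black ∷ c) h → Path g s c h
Path-unflat-wb (flat-wb p) = p

Path-expand : ∀ {g h y s c} → Path g (white ∷ s) (y ∷ c) h → Path g (black ∷ white ∷ s) (y ∷ white ∷ c) h
Path-expand (flat-wb p) = up (down p)
Path-expand (down p)    = flat-bw (down p)

Path-contract : ∀ {g h y s c} → Path g (black ∷ white ∷ s) (y ∷ white ∷ c) h → Path g (white ∷ s) (y ∷ c) h
Path-contract (up (down p))      = flat-wb p
Path-contract (flat-bw (down p)) = down p

Path-unsnoc-bw : ∀ xs ys {g h} → length xs ≡ length ys → Path g (xs ++ black ∷ []) (ys ++ white ∷ []) h → Path g xs ys h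
Path-unsnoc-bw xs ys len p with Path-++⁻ xs ys len p
... | _ , p₁ , flat-bw [] = p₁

Move-path : ∀ {n t b i t' b' j} → Move n (t , b) i (t' , b') j → Path 0 t b 0 → Path 0 t' b' 0
Move-path (move-a′ p q u w y v _ lu _) =
  Path-local p u (sym lu) flat-wb ∘ Path-local p u (sym lu) (Path-local (whites (length w)) w (length-replicate _)
    (Path-local (black ∷ []) (y ∷ []) refl Path-unflat-wb))
Move-path (move-a″ p r u x w y v lu _) = Path-local p u (sym lu) λ path →
  subst (λ s → Path _ (white ∷ s) _ _) (replicate-++-∷ (length w) black (white ∷ r))
    (Path-local (white ∷ blacks (length w)) (x ∷ w) (cong suc (length-replicate _)) Path-expand (Path-contract path))
Move-path (move-a″-end p u x w lu _) = Path-local p u (sym lu) λ path →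
  subst (λ s → Path _ (white ∷ s) (x ∷ w ++ white ∷ []) _) (replicate-∷ʳ (length w) black)
    (Path-++⁺ (Path-contract path) (flat-bw []))
Move-path (move-b r w y v _) path =
  subst (λ s → Path 0 s _ 0) (replicate-++-∷ (length w) black (white ∷ r))
    (Path-local (blacks (length w)) w (length-replicate _) Path-expand (Path-unflat-wb path))
Move-path (move-b-end w _) path =
  subst (λ s → Path 0 s (w ++ white ∷ []) 0) (replicate-∷ʳ (length w) black)
    (Path-++⁺ (Path-unflat-wb path) (flat-bw []))
Move-path (move-c p u w _ lu _) = Path-local p u (sym lu) (λ path → flat-wb (Path-unsnoc-bw (whites (length w)) w (length-replicate _) path))
Move-path (fixed-0 _ _ _)       = id
Move-path (fixed-n _ _ _ _ _)   = id
Move-path (fixed _ _ _ _ _)     = id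

length-++-cong : ∀ {A : Set} (p : List A) {ys zs} → length ys ≡ length zs → length (p ++ ys) ≡ length (p ++ zs)
length-++-cong p e = trans (length-++ p) (trans (cong (length p +_) e) (sym (length-++ p)))

Move-length : ∀ {n t b i t' b' j} → Move n (t , b) i (t' , b') j → length t' ≡ length t
Move-length (move-a′ p q u w y v _ _ _) = length-++-cong p
  (trans (cong suc (length-++-sucʳ W black q)) (sym (trans (length-++-sucʳ W black (white ∷ q)) (cong suc (length-++-sucʳ W white q)))))
  where W = whites (length w)
Move-length (move-a″ p r u x w y v _ _) = length-++-cong p refl
Move-length (move-a″-end p u x w _ _)   = length-++-cong p refl
Move-length (move-b r w y v _)          = refl
Move-length (move-b-end w _)            = refl
Move-length (move-c p u w _ _ _)        = length-++-cong p
  (sym (trans (length-++-sucʳ W black []) (cong (λ l → suc (length l)) (++-identityʳ W))))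
  where W = whites (length w)
Move-length (fixed-0 _ _ _)             = refl
Move-length (fixed-n _ _ _ _ _)         = refl
Move-length (fixed _ _ _ _ _)           = refl

Move-complete : ∀ {n t b i t' b' j} → Move n (t , b) i (t' , b') j → Complete n (t , b) → Complete n (t' , b')
Move-complete mv (len-t , _ , path) = len-t' , trans (sym (Path-length path')) len-t' , path'
  where
  path' = Move-path mv path
  len-t' = trans (Move-length mv) len-t


-- Undoing T

-- Tinv n (t , b) j recovers the argument of T from its value (t , b) and J = j. Wall j is marked
-- when cells j and j + 1 of t are • and ∘ (reading cell 0 as • and cell n + 1 as ∘), which fails
-- exactly in case (d). A black in b right after wall j is the column (∘,•) inserted in cases (a′)
-- and (c); otherwise the move was (b) or (a″), according as the black run of t ending at cell j
-- starts at cell 1 or not.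
marked : ℕ → List Particle → ℕ → Bool
marked n t zero    = isWhite (cell t 1)
marked n t (suc j) = if suc j <ᵇ n then isBlack (cell t (suc j)) ∧ isWhite (cell t (suc (suc j))) else isBlack (cell t n)

insertedAfter : ℕ → List Particle → ℕ → Bool
insertedAfter n b j = (j <ᵇ n) ∧ isBlack (cell b (suc j))

runStart : List Particle → ℕ → ℕ
runStart t zero    = zero
runStart t (suc j) = if isBlack (cell t (suc j)) then runStart t j else suc j

undo-a′-c : ℕ → Rows → ℕ → List Particle × List Particle → Rows × ℕ
undo-a′-c n (t , b) j (ws , [])    = (take j t ++ ws ++ black ∷ [] , deleteAt (suc j) b ++ white ∷ []) , n
undo-a′-c n (t , b) j (ws , _ ∷ q) =
  (take j t ++ ws ++ black ∷ white ∷ q , insertAt (suc (suc (j + length ws))) black (deleteAt (suc j) b)) , suc (j + length ws)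

undo-a″-b : ℕ → Rows → ℕ → ℕ → Rows × ℕ
undo-a″-b n (t , b) j zero    = (white ∷ drop 1 t , black ∷ deleteAt (bottomPos n j) b) , 0
undo-a″-b n (t , b) j (suc s) =
  (take s t ++ black ∷ white ∷ drop (suc (suc s)) t , insertAt (suc (suc s)) white (deleteAt (bottomPos n j) b)) , suc s

Tinv : ℕ → Rows → ℕ → Rows × ℕ
Tinv n (t , b) j =
  if marked n t j
  then (if insertedAfter n b j then undo-a′-c n (t , b) j (spanᵇ isWhite (drop (suc j) t)) else undo-a″-b n (t , b) j (runStart t j))
  else ((t , b) , j)

Tinv≡id : ∀ {n t b j} → marked n t j ≡ false → Tinv n (t , b) j ≡ ((t , b) , j)
Tinv≡id e rewrite e = refl

Tinv≡undo-a′-c : ∀ {n t b j} → marked n t j ≡ true → insertedAfter n b j ≡ true →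
  Tinv n (t , b) j ≡ undo-a′-c n (t , b) j (spanᵇ isWhite (drop (suc j) t))
Tinv≡undo-a′-c e e' rewrite e | e' = refl

Tinv≡undo-a″-b : ∀ {n t b j} → marked n t j ≡ true → insertedAfter n b j ≡ false →
  Tinv n (t , b) j ≡ undo-a″-b n (t , b) j (runStart t j)
Tinv≡undo-a″-b e e' rewrite e | e' = refl

marked-inner : ∀ {n t j} → suc j < n → cell t (suc j) ≡ black → cell t (suc (suc j)) ≡ white → marked n t (suc j) ≡ true
marked-inner j<n tⱼ tⱼ₊₁ rewrite <⇒<ᵇ≡true j<n | tⱼ | tⱼ₊₁ = refl

marked-border : ∀ {t n} → cell t (suc n) ≡ black → marked (suc n) t (suc n) ≡ true
marked-border {n = n} tₙ rewrite <ᵇ-irrefl n | tₙ = refl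

marked-seam : ∀ {n p} ys → EndsInBlack p → length p < n → marked n (p ++ white ∷ ys) (length p) ≡ true
marked-seam ys [] _ = refl
marked-seam {n} ys (snoc p) L<n =
  subst (λ L → marked n t L ≡ true) (sym L≡)
    (marked-inner {n} {t} (subst (_< n) L≡ L<n)
      (subst (λ L → cell t L ≡ black) L≡ (EndsInBlack-cell (white ∷ ys) (snoc p) (subst (0 <_) (sym L≡) (s≤s z≤n))))
      (cell-++ (p ++ black ∷ []) (trans (sym L≡) (n≡n+0 _))))
  where
  t = (p ++ black ∷ []) ++ white ∷ ys
  L≡ : length (p ++ black ∷ []) ≡ suc (length p)
  L≡ = trans (length-++ p) (+-comm (length p) 1)

unmarked-0 : ∀ {n t} → cell t 1 ≡ black → marked n t 0 ≡ false
unmarked-0 t₁ rewrite t₁ = refl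

unmarked-inner : ∀ {n t i} → suc i < n → ¬ (cell t (suc i) ≡ black × cell t (suc (suc i)) ≡ white) → marked n t (suc i) ≡ false
unmarked-inner {t = t} {i} i<n not rewrite <⇒<ᵇ≡true i<n = not-bw (cell t (suc i)) (cell t (suc (suc i))) not
  where
  not-bw : ∀ x y → ¬ (x ≡ black × y ≡ white) → (isBlack x ∧ isWhite y) ≡ false
  not-bw black white not = contradiction (refl , refl) not
  not-bw black black _   = refl
  not-bw white _     _   = refl

unmarked-border : ∀ {t n} → cell t (suc n) ≡ white → marked (suc n) t (suc n) ≡ false
unmarked-border {n = n} tₙ rewrite <ᵇ-irrefl n | tₙ = refl

insertedAfter-black : ∀ {n b j} → j < n → cell b (suc j) ≡ black → insertedAfter n b j ≡ true
insertedAfter-black j<n bⱼ₊₁ rewrite <⇒<ᵇ≡true j<n | bⱼ₊₁ = refl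

insertedAfter-white : ∀ {n b j} → cell b (suc j) ≡ white → insertedAfter n b j ≡ false
insertedAfter-white {n} {j = j} bⱼ₊₁ rewrite bⱼ₊₁ with j <ᵇ n
... | true  = refl
... | false = refl

insertedAfter-border : ∀ {n b} → insertedAfter n b n ≡ false
insertedAfter-border {n} rewrite <ᵇ-irrefl n = refl

runStart-black : ∀ {t s} → cell t (suc s) ≡ black → runStart t (suc s) ≡ runStart t s
runStart-black tₛ rewrite tₛ = refl

runStart-white : ∀ {t s} → cell t (suc s) ≡ white → runStart t (suc s) ≡ suc s
runStart-white tₛ rewrite tₛ = refl

runStart-blacks : ∀ t s k → (∀ c → s < c → c ≤ s + k → cell t c ≡ black) → runStart t (s + k) ≡ runStart t s
runStart-blacks t s zero    _   = cong (runStart t) (+-identityʳ s)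
runStart-blacks t s (suc k) run =
  trans (cong (runStart t) (+-suc s k))
    (trans (runStart-black {t} {s + k} (run (suc (s + k)) (s≤s (m≤m+n s k)) (≤-reflexive (sym (+-suc s k)))))
      (runStart-blacks t s k (λ c lo hi → run c lo (≤-trans hi (≤-trans (n≤1+n _) (≤-reflexive (sym (+-suc s k))))))))

spanᵇ-whites : ∀ k → spanᵇ isWhite (whites k) ≡ (whites k , [])
spanᵇ-whites zero    = refl
spanᵇ-whites (suc k) rewrite spanᵇ-whites k = refl

spanᵇ-whites-black : ∀ k q → spanᵇ isWhite (whites k ++ black ∷ q) ≡ (whites k , black ∷ q)
spanᵇ-whites-black zero    q = refl
spanᵇ-whites-black (suc k) q rewrite spanᵇ-whites-black k q = refl

private
  runStart-after-white : ∀ p s k → (∀ c → suc (length p) < c → c ≤ suc (length p) + k → cell (p ++ white ∷ s) c ≡ black) →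
                        runStart (p ++ white ∷ s) (suc (length p) + k) ≡ suc (length p)
  runStart-after-white p s k run =
    trans (runStart-blacks (p ++ white ∷ s) (suc (length p)) k run) (runStart-white (cell-++ p (n≡n+0 _)))

  blacks-after₁ : ∀ p m ys c → suc (length p) < c → c ≤ suc (length p) + m →
                      cell (p ++ white ∷ replicate m black ++ ys) c ≡ black
  blacks-after₁ p m ys c lo hi =
    subst (λ t → cell t c ≡ black) (++-assoc p (white ∷ []) _)
      (cell-replicate (p ++ white ∷ []) m black ys c (subst (_< c) (sym len₁) lo) (subst (λ l → c ≤ l + m) (sym len₁) hi))
    where len₁ : length (p ++ white ∷ []) ≡ suc (length p)
          len₁ = trans (length-++ p) (+-comm (length p) 1)

Tinv-a′ : ∀ {n} p q u w y v → EndsInBlack p → length u ≡ length p → suc (length p + length w) < n →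
  Tinv n (p ++ white ∷ whites (length w) ++ black ∷ q , u ++ black ∷ w ++ y ∷ v) (length p)
    ≡ ((p ++ whites (length w) ++ black ∷ white ∷ q , u ++ w ++ y ∷ black ∷ v) , suc (length p + length w))
Tinv-a′ {n} p q u w y v eb lu i<n =
  trans (Tinv≡undo-a′-c {n} {t'} {b'} (marked-seam (whites k ++ black ∷ q) eb L<n)
                                      (insertedAfter-black {n} {b'} L<n (cell-++ u (aligned+0 lu))))
    (trans (cong (undo-a′-c n (t' , b') L) span≡) (cong₂ _,_ (cong₂ _,_ top bottom) (cong (λ l → suc (L + l)) (length-replicate k))))
  where
  L = length p
  k = length w
  t' = p ++ white ∷ whites k ++ black ∷ q
  b' = u ++ black ∷ w ++ y ∷ v
  L<n : L < n
  L<n = ≤-trans (s≤s (m≤m+n L k)) (<⇒≤ i<n)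
  span≡ : spanᵇ isWhite (drop (suc L) t') ≡ (whites k , black ∷ q)
  span≡ = trans (cong (spanᵇ isWhite) (drop-++ p (1+n≡n+1 L))) (spanᵇ-whites-black k q)
  top : take L t' ++ whites k ++ black ∷ white ∷ q ≡ p ++ whites k ++ black ∷ white ∷ q
  top = cong (_++ _) (take-length-++ p)
  bottom : insertAt (suc (suc (L + length (whites k)))) black (deleteAt (suc L) b') ≡ u ++ w ++ y ∷ black ∷ v
  bottom = trans (cong (insertAt (suc (suc (L + length (whites k)))) black) (deleteAt-++ u (aligned+0 lu)))
             (trans (insertAt-++ u (trans (sym (+-suc L (length (whites k)))) (cong₂ (λ a b → a + suc b) (sym lu) (length-replicate k))))
               (cong (u ++_) (insertAt-++ w (1+n≡n+1 k))))

Tinv-c : ∀ {n} p u w → EndsInBlack p → length u ≡ length p → suc (length p + length w) ≡ n →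
  Tinv n (p ++ white ∷ whites (length w) , u ++ black ∷ w) (length p)
    ≡ ((p ++ whites (length w) ++ black ∷ [] , u ++ w ++ white ∷ []) , n)
Tinv-c {n} p u w eb lu refl =
  trans (Tinv≡undo-a′-c {n} {t'} {b'} (marked-seam (whites k) eb L<n) (insertedAfter-black {n} {b'} L<n (cell-++ u (aligned+0 lu))))
    (trans (cong (undo-a′-c n (t' , b') L) span≡) (cong (_, n) (cong₂ _,_ top bottom)))
  where
  L = length p
  k = length w
  t' = p ++ white ∷ whites k
  b' = u ++ black ∷ w
  L<n : L < n
  L<n = s≤s (m≤m+n L k)
  span≡ : spanᵇ isWhite (drop (suc L) t') ≡ (whites k , [])
  span≡ = trans (cong (spanᵇ isWhite) (drop-++ p (1+n≡n+1 L))) (spanᵇ-whites k)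
  top : take L t' ++ whites k ++ black ∷ [] ≡ p ++ whites k ++ black ∷ []
  top = cong (_++ _) (take-length-++ p)
  bottom : deleteAt (suc L) b' ++ white ∷ [] ≡ u ++ w ++ white ∷ []
  bottom = trans (cong (_++ white ∷ []) (deleteAt-++ u (aligned+0 lu))) (++-assoc u w _)

Tinv-b : ∀ {n} r w y v → suc (length w) < n →
  Tinv n (black ∷ blacks (length w) ++ white ∷ r , w ++ y ∷ white ∷ v) (suc (length w))
    ≡ ((white ∷ blacks (length w) ++ white ∷ r , black ∷ w ++ y ∷ v) , 0)
Tinv-b {n} r w y v j<n =
  trans (Tinv≡undo-a″-b {n} {t'} {b'} (marked-inner {n} {t'} j<n (cell-replicate [] (suc m) black (white ∷ r) (suc m) z<s ≤-refl)
                                                   (cell-++ (black ∷ blacks m) (cong suc (length-blacks+0 m))))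
                                      (insertedAfter-white {n} {b'} (cell-++ w (1+n≡n+1 m))))
    (trans (cong (undo-a″-b n (t' , b') (suc m)) (runStart-blacks t' 0 (suc m) (cell-replicate [] (suc m) black (white ∷ r))))
      (cong (λ l → (white ∷ blacks m ++ white ∷ r , black ∷ l) , 0)
        (trans (cong (λ k → deleteAt k b') (bottomPos-< j<n)) (deleteAt-++ w (1+n≡n+1 m)))))
  where
  m = length w
  t' = black ∷ blacks m ++ white ∷ r
  b' = w ++ y ∷ white ∷ v

Tinv-b-end : ∀ {n} w → suc (length w) ≡ n →
  Tinv n (black ∷ blacks (length w) , w ++ white ∷ []) n ≡ ((white ∷ blacks (length w) , black ∷ w) , 0)
Tinv-b-end {n} w refl =
  trans (Tinv≡undo-a″-b {n} {t'} {b'} (marked-border {t'} {m} (cell-replicate-end [] (suc m) black (suc m) (s≤s z≤n) ≤-refl))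
                                      (insertedAfter-border {n} {b'}))
    (trans (cong (undo-a″-b n (t' , b') n) (runStart-blacks t' 0 (suc m) (cell-replicate-end [] (suc m) black)))
      (cong (λ l → (white ∷ blacks m , black ∷ l) , 0)
        (trans (cong (λ k → deleteAt k b') (bottomPos-n n)) (trans (deleteAt-++ w (n≡n+0 m)) (++-identityʳ w)))))
  where
  m = length w
  t' = black ∷ blacks m
  b' = w ++ white ∷ []

Tinv-a″ : ∀ {n} p r u x w y v → length u ≡ length p → suc (suc (length p + length w)) < n →
  Tinv n (p ++ white ∷ black ∷ blacks (length w) ++ white ∷ r , u ++ x ∷ w ++ y ∷ white ∷ v) (suc (suc (length p + length w)))
    ≡ ((p ++ black ∷ white ∷ blacks (length w) ++ white ∷ r , u ++ x ∷ white ∷ w ++ y ∷ v) , suc (length p))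
Tinv-a″ {n} p r u x w y v lu j<n =
  trans (Tinv≡undo-a″-b {n} {t'} {b'} (marked-inner {n} {t'} j<n tⱼ tⱼ₊₁) (insertedAfter-white {n} {b'} bⱼ₊₁))
    (trans (cong (undo-a″-b n (t' , b') j) start≡)
      (cong (_, suc L) (cong₂ _,_ (cong₂ (λ a d → a ++ black ∷ white ∷ d) (take-length-++ p) (drop-++ p (2+n≡n+2 L))) bottom)))
  where
  L = length p
  m = length w
  j = suc (suc (L + m))
  t' = p ++ white ∷ black ∷ blacks m ++ white ∷ r
  b' = u ++ x ∷ w ++ y ∷ white ∷ v
  j≡ : suc (suc (L + m)) ≡ length u + suc (suc m)
  j≡ = trans (a″-index L m) (cong (_+ suc (suc m)) (sym lu))
  start≡ : runStart t' j ≡ suc L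
  start≡ = trans (cong (runStart t') (cong suc (sym (+-suc L m))))
             (runStart-after-white p (black ∷ blacks m ++ white ∷ r) (suc m) (blacks-after₁ p (suc m) (white ∷ r)))
  tⱼ : cell t' j ≡ black
  tⱼ = trans (cell-++ p (sym (+-suc L m))) (cell-replicate [] (suc m) black (white ∷ r) (suc m) (s≤s z≤n) ≤-refl)
  tⱼ₊₁ : cell t' (suc j) ≡ white
  tⱼ₊₁ = trans (cell-++ p (a″-index L m)) (cell-++ (blacks m) (length-blacks+0 m))
  bⱼ₊₁ : cell b' (suc j) ≡ white
  bⱼ₊₁ = trans (cell-++ u j≡) (cell-++ w (1+n≡n+1 m))
  bottom : insertAt (suc (suc L)) white (deleteAt (bottomPos n j) b') ≡ u ++ x ∷ white ∷ w ++ y ∷ v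
  bottom = trans (cong (λ k → insertAt (suc (suc L)) white (deleteAt k b')) (bottomPos-< j<n))
             (trans (cong (insertAt (suc (suc L)) white)
                      (trans (deleteAt-++ u j≡) (cong (λ z → u ++ x ∷ z) (deleteAt-++ w (1+n≡n+1 m)))))
               (insertAt-++ u (aligned+1 lu)))

Tinv-a″-end : ∀ {n} p u x w → length u ≡ length p → suc (suc (length p + length w)) ≡ n →
  Tinv n (p ++ white ∷ black ∷ blacks (length w) , u ++ x ∷ w ++ white ∷ []) n
    ≡ ((p ++ black ∷ white ∷ blacks (length w) , u ++ x ∷ white ∷ w) , suc (length p))
Tinv-a″-end {n} p u x w lu refl =
  trans (Tinv≡undo-a″-b {n} {t'} {b'} (marked-border {t'} {suc (L + m)} tₙ) (insertedAfter-border {n} {b'}))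
    (trans (cong (undo-a″-b n (t' , b') n) start≡)
      (cong (_, suc L) (cong₂ _,_ (cong₂ (λ a d → a ++ black ∷ white ∷ d) (take-length-++ p) (drop-++ p (2+n≡n+2 L))) bottom)))
  where
  L = length p
  m = length w
  t' = p ++ white ∷ black ∷ blacks m
  b' = u ++ x ∷ w ++ white ∷ []
  tₙ : cell t' (suc (suc (L + m))) ≡ black
  tₙ = trans (cell-++ p (sym (+-suc L m))) (cell-replicate-end [] (suc m) black (suc m) (s≤s z≤n) ≤-refl)
  start≡ : runStart t' n ≡ suc L
  start≡ = trans (cong (runStart t') (cong suc (sym (+-suc L m))))
             (runStart-after-white p (black ∷ blacks m) (suc m) λ c lo hi →
                subst (λ l → cell (p ++ white ∷ l) c ≡ black) (++-identityʳ _) (blacks-after₁ p (suc m) [] c lo hi))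
  bottom : insertAt (suc (suc L)) white (deleteAt (bottomPos n n) b') ≡ u ++ x ∷ white ∷ w
  bottom = trans (cong (λ k → insertAt (suc (suc L)) white (deleteAt k b')) (bottomPos-n n))
             (trans (cong (insertAt (suc (suc L)) white)
                      (trans (deleteAt-++ u (trans (sym (+-suc L m)) (cong (_+ suc m) (sym lu))))
                             (cong (λ z → u ++ x ∷ z) (trans (deleteAt-++ w (n≡n+0 m)) (++-identityʳ w)))))
               (insertAt-++ u (aligned+1 lu)))

Move⇒Tinv : ∀ {n t b i t' b' j} → Move n (t , b) i (t' , b') j → Tinv n (t' , b') j ≡ ((t , b) , i)
Move⇒Tinv (move-a′ p q u w y v eb lu i<n) = Tinv-a′ p q u w y v eb lu i<n
Move⇒Tinv (move-a″ p r u x w y v lu j<n)  = Tinv-a″ p r u x w y v lu j<n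
Move⇒Tinv (move-a″-end p u x w lu j≡n)    = Tinv-a″-end p u x w lu j≡n
Move⇒Tinv (move-b r w y v j<n)            = Tinv-b r w y v j<n
Move⇒Tinv (move-b-end w j≡n)              = Tinv-b-end w j≡n
Move⇒Tinv (move-c p u w eb lu n≡)         = Tinv-c p u w eb lu n≡
Move⇒Tinv {n} (fixed-0 t b t₁)            = Tinv≡id {n} {t} {b} (unmarked-0 {n} {t} t₁)
Move⇒Tinv (fixed-n t b n' refl tₙ)        = Tinv≡id {t = t} {b} (unmarked-border {t} {n'} tₙ)
Move⇒Tinv {n} (fixed t b i i<n not)       = Tinv≡id {n} {t} {b} (unmarked-inner {n} {t} i<n not)

-- Every wall falls into one of the cases

module _ {A : Set} where

  split : ∀ k (xs : List A) → k ≤ length xs → ∃₂ λ ys zs → length ys ≡ k × xs ≡ ys ++ zs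
  split zero    xs       _        = [] , xs , refl , refl
  split (suc k) (x ∷ xs) (s≤s k≤) with split k xs k≤
  ... | ys , zs , refl , refl = x ∷ ys , zs , refl , refl

  split∷ : ∀ k (xs : List A) → k < length xs → ∃₂ λ ys y → ∃ λ zs → length ys ≡ k × xs ≡ ys ++ y ∷ zs
  split∷ k xs k< with split k xs (<⇒≤ k<)
  ... | ys , []     , refl , refl = contradiction (subst (length ys <_) (length-++ ys) k<) (≤⇒≯ (≤-reflexive (+-identityʳ _)))
  ... | ys , y ∷ zs , refl , refl = ys , y , zs , refl , refl

whiteSuffix : ∀ P → ∃₂ λ p k → EndsInBlack p × P ≡ p ++ whites k
whiteSuffix []      = [] , 0 , [] , refl
whiteSuffix (x ∷ P) with whiteSuffix P
... | _ , k , snoc p , refl = x ∷ p ++ black ∷ [] , k , snoc (x ∷ p) , refl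
... | _ , k , [] , refl with x
...   | black = black ∷ [] , k , snoc [] , refl
...   | white = [] , suc k , [] , refl

data BlackRun : List Particle → Set where
  run            : ∀ m → BlackRun (blacks m)
  run-then-white : ∀ m r → BlackRun (blacks m ++ white ∷ r)

blackRun : ∀ xs → BlackRun xs
blackRun []           = run 0
blackRun (white ∷ xs) = run-then-white 0 xs
blackRun (black ∷ xs) with blackRun xs
... | run m              = run (suc m)
... | run-then-white m r = run-then-white (suc m) r

module _ {A : Set} where

  focus₂ : ∀ k (xs : List A) → suc k < length xs →
           ∃₂ λ P x₁ → ∃₂ λ x₂ q → length P ≡ k × xs ≡ P ++ x₁ ∷ x₂ ∷ q
  focus₂ zero    (x₁ ∷ x₂ ∷ q) _                = [] , x₁ , x₂ , q , refl , refl
  focus₂ zero    (x₁ ∷ [])     (s≤s ())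
  focus₂ (suc k) (x ∷ xs)      (s≤s k<) with focus₂ k xs k<
  ... | P , x₁ , x₂ , q , refl , refl = x ∷ P , x₁ , x₂ , q , refl , refl

  focus-last : ∀ k (xs : List A) → length xs ≡ suc k → ∃₂ λ P x → length P ≡ k × xs ≡ P ++ x ∷ []
  focus-last zero    (x ∷ [])     _   = [] , x , refl , refl
  focus-last (suc k) (x ∷ y ∷ xs) len with focus-last k (y ∷ xs) (suc-injective len)
  ... | P , z , refl , e = x ∷ P , z , refl , cong (x ∷_) e

cast : ∀ {n t t' b b' i i'} → t ≡ t' → b ≡ b' → i ≡ i' → ∃₂ (Move n (t' , b') i') → ∃₂ (Move n (t , b) i)
cast refl refl refl mv = mv

length-blacks-++ : ∀ m ys → length (blacks m ++ ys) ≡ m + length ys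
length-blacks-++ m ys = trans (length-++ (blacks m)) (cong (_+ length ys) (length-replicate m))

length-++-∷∷ : ∀ {A : Set} (xs : List A) {y z zs} → length (xs ++ y ∷ z ∷ zs) ≡ suc (suc (length xs + length zs))
length-++-∷∷ xs {zs = zs} = trans (length-++ xs) (trans (+-suc (length xs) _) (cong suc (+-suc (length xs) (length zs))))

length-++-whites : ∀ p k → length (p ++ whites k) ≡ length p + k
length-++-whites p k = trans (length-++ p) (cong (length p +_) (length-replicate k))

length-suffix : ∀ {n} (P B : List Particle) {xs ys} → length (P ++ xs) ≡ n → length (B ++ ys) ≡ n →
  length B ≡ length P → length ys ≡ length xs
length-suffix P B len-t len-b lB = +-cancelˡ-≡ (length P) _ _
  (trans (cong (_+ _) (sym lB)) (trans (sym (length-++ B)) (trans len-b (trans (sym len-t) (length-++ P)))))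

whiteSuffix-aligned : ∀ P (B : List Particle) → length B ≡ length P →
  ∃₂ λ p u → ∃ λ w → EndsInBlack p × length u ≡ length p × P ≡ p ++ whites (length w) × B ≡ u ++ w
whiteSuffix-aligned P B lB with whiteSuffix P
... | p , k , eb , refl with split (length p) B (subst (length p ≤_) (sym (trans lB (length-++-whites p k))) (m≤m+n _ _))
...   | u , w , lu , refl = p , u , w , eb , lu , cong (λ k → p ++ whites k) (sym length-w) , refl
  where
  length-w : length w ≡ k
  length-w = +-cancelˡ-≡ (length p) _ _ (trans (cong (_+ length w) (sym lu)) (trans (sym (length-++ u)) (trans lB (length-++-whites p k))))

Path-last-white : ∀ xs ys {g z} → length xs ≡ length ys → Path g (xs ++ black ∷ []) (ys ++ z ∷ []) 0 → z ≡ white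
Path-last-white xs ys len p with Path-++⁻ xs ys len p
... | _ , _ , flat-bw [] = refl

classify-b : ∀ {n} q v → length v ≡ length q → suc (length q) ≡ n → ∃₂ (Move n (white ∷ q , black ∷ v) 0)
classify-b q v lv len-t with blackRun q
... | run m with trans lv (length-replicate m)
...   | refl = _ , _ , move-b-end v (trans (cong suc (sym (length-replicate _))) len-t)
classify-b _ v lv len-t | run-then-white m r
  with split∷ m v (subst (m <_) (trans (sym (length-blacks-++ m (white ∷ r))) (sym lv)) (m<m+n m z<s))
... | w , y , v' , refl , refl =
  _ , _ , move-b r w y v' (subst (suc (length w) <_) (trans (cong suc (sym (length-blacks-++ _ (white ∷ r)))) len-t) (s≤s (m<m+n _ z<s)))

classify-a″ : ∀ {n} P q B x v → length B ≡ length P → length v ≡ length q → length (P ++ black ∷ white ∷ q) ≡ n →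
  ∃₂ (Move n (P ++ black ∷ white ∷ q , B ++ x ∷ white ∷ v) (suc (length P)))
classify-a″ P q B x v lB lv len-t with blackRun q
... | run m with trans lv (length-replicate m)
...   | refl = _ , _ , move-a″-end P B x v lB
                 (trans (cong (λ l → suc (suc (length P + l))) (sym (length-replicate _))) (trans (sym (length-++-∷∷ P)) len-t))
classify-a″ P _ B x v lB lv len-t | run-then-white m r
  with split∷ m v (subst (m <_) (trans (sym (length-blacks-++ m (white ∷ r))) (sym lv)) (m<m+n m z<s))
... | w , y , v' , refl , refl = _ , _ , move-a″ P r B x w y v' lB (subst (suc (suc (length P + length w)) <_) n≡ run<)
  where
  n≡ : suc (suc (length P + (length w + suc (length r)))) ≡ _
  n≡ = trans (cong (λ l → suc (suc (length P + l))) (sym (length-blacks-++ (length w) (white ∷ r)))) (trans (sym (length-++-∷∷ P)) len-t)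
  run< : suc (suc (length P + length w)) < suc (suc (length P + (length w + suc (length r))))
  run< = s≤s (s≤s (+-monoʳ-< (length P) (m<m+n (length w) z<s)))

classify-inner : ∀ {n} P x₁ x₂ q B z₁ z₂ v → length B ≡ length P → suc (length P) < n →
  Complete n (P ++ x₁ ∷ x₂ ∷ q , B ++ z₁ ∷ z₂ ∷ v) →
  ∃₂ (Move n (P ++ x₁ ∷ x₂ ∷ q , B ++ z₁ ∷ z₂ ∷ v) (suc (length P)))
classify-inner {n} P black white q B z₁ black v lB i<n _ with whiteSuffix-aligned P B lB
... | p , u , w , eb , lu , refl , refl =
  cast (++-assoc p (whites (length w)) _) (++-assoc u w _) (cong suc (length-++-whites p _))
    (_ , _ , move-a′ p q u w z₁ v eb lu (subst (_< n) (cong suc (length-++-whites p _)) i<n))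
classify-inner P black white q B z₁ white v lB _ (len-t , len-b , _) =
  classify-a″ P q B z₁ v lB (suc-injective (suc-injective (length-suffix P B len-t len-b lB))) len-t
classify-inner P black black q B z₁ z₂ v lB i<n _ =
  _ , _ , fixed _ _ (length P) i<n (λ (_ , e) → case trans (sym (cell-++ P (1+n≡n+1 _))) e of λ ())
classify-inner P white x₂ q B z₁ z₂ v lB i<n _ =
  _ , _ , fixed _ _ (length P) i<n (λ (e , _) → case trans (sym (cell-++ P (n≡n+0 _))) e of λ ())

classify-n : ∀ {n} P x B z → length B ≡ length P → suc (length P) ≡ n →
  Complete n (P ++ x ∷ [] , B ++ z ∷ []) → ∃₂ (Move n (P ++ x ∷ [] , B ++ z ∷ []) n)
classify-n P white B z lB refl _ = _ , _ , fixed-n _ _ _ refl (cell-++ P (n≡n+0 _))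
classify-n P black B z lB refl (_ , _ , path) with Path-last-white P B (sym lB) path | whiteSuffix-aligned P B lB
... | refl | p , u , w , eb , lu , refl , refl =
  cast (++-assoc p (whites (length w)) _) (++-assoc u w _) refl
    (_ , _ , move-c p u w eb lu (cong suc (sym (length-++-whites p _))))

classify : ∀ {n t b i} → 1 ≤ n → i ≤ n → Complete n (t , b) → ∃₂ (Move n (t , b) i)
classify {t = []}                   (s≤s z≤n) _ (() , _)
classify {t = _ ∷ _} {[]}           (s≤s z≤n) _ (_ , () , _)
classify {t = black ∷ _} {_ ∷ _} {zero} _ _ _ = _ , _ , fixed-0 _ _ refl
classify {t = white ∷ q} {_ ∷ v} {zero} _ _ (len-t , _ , flat-wb path) = classify-b q v (sym (Path-length path)) len-t
classify {n} {t} {b} {suc i} _ i≤n c@(len-t , len-b , _) with m≤n⇒m<n∨m≡n i≤n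
... | inj₁ i<n with focus₂ i t (subst (suc i <_) (sym len-t) i<n) | focus₂ i b (subst (suc i <_) (sym len-b) i<n)
...   | P , x₁ , x₂ , q , refl , refl | B , z₁ , z₂ , v , lB , refl = classify-inner P x₁ x₂ q B z₁ z₂ v lB i<n c
classify {n} {t} {b} {suc i} _ i≤n c@(len-t , len-b , _) | inj₂ refl
  with focus-last i t len-t | focus-last i b len-b
... | P , x , refl , refl | B , z , lB , refl = classify-n P x B z lB refl c

lookup-injective : ∀ {A : Set} {xs : List A} → Unique xs → ∀ {i j} → lookup xs i ≡ lookup xs j → i ≡ j
lookup-injective (_ ∷ _)   {zero}  {zero}  _ = refl
lookup-injective (x∉ ∷ _)  {zero}  {suc j} e = contradiction e (All.lookup x∉ (∈-lookup j))
lookup-injective (x∉ ∷ _)  {suc i} {zero}  e = contradiction (sym e) (All.lookup x∉ (∈-lookup i))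
lookup-injective (_ ∷ xs!) {suc i} {suc j} e = cong suc (lookup-injective xs! e)

Fin-injective⇒surjective : ∀ {m} {f : Fin m → Fin m} → Injective _≡_ _≡_ f → ∀ k → ∃ λ j → f j ≡ k
Fin-injective⇒surjective {suc m} {f} f-inj k with any? (λ j → f j ≟ᶠ k)
... | yes hit = hit
... | no miss = contradiction (injective⇒≤ punchOut∘f-injective) (n≮n m)
  where
  punchOut∘f : Fin (suc m) → Fin m
  punchOut∘f j = punchOut (λ e → miss (j , sym e))
  punchOut∘f-injective : Injective _≡_ _≡_ punchOut∘f
  punchOut∘f-injective {i} {j} e = f-inj (punchOut-injective (λ e → miss (i , sym e)) (λ e → miss (j , sym e)) e)

module _ {A : Set} (_≟_ : DecidableEquality A) {xs : List A} (complete : ∀ x → x ∈ xs) where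

  private
    distinct = deduplicate _≟_ xs

    encode : A → Fin (length distinct)
    encode x = index (∈-deduplicate⁺ _≟_ (complete x))

    decode-encode : ∀ x → lookup distinct (encode x) ≡ x
    decode-encode x = sym (lookup-index (∈-deduplicate⁺ _≟_ (complete x)))

  injective⇒surjective : ∀ {f : A → A} → Injective _≡_ _≡_ f → Surjective _≡_ _≡_ f
  injective⇒surjective {f} f-inj y = lookup distinct j , λ { refl → f-j≡y }
    where
    h-injective : Injective _≡_ _≡_ (λ i → encode (f (lookup distinct i)))
    h-injective e = lookup-injective (deduplicate-! _≟_ xs)
      (f-inj (trans (sym (decode-encode _)) (trans (cong (lookup distinct) e) (decode-encode _))))
    hit = Fin-injective⇒surjective h-injective (encode y)
    j = proj₁ hit
    f-j≡y : f (lookup distinct j) ≡ y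
    f-j≡y = trans (sym (decode-encode _)) (trans (cong (lookup distinct) (proj₂ hit)) (decode-encode y))

_≟ₚ_ : DecidableEquality Particle
black ≟ₚ black = yes refl
black ≟ₚ white = no λ ()
white ≟ₚ black = no λ ()
white ≟ₚ white = yes refl

Ω⁰-≡ : ∀ {n} {ω ω' : Ω⁰ n} → rows ω ≡ rows ω' → ω ≡ ω'
Ω⁰-≡ {ω = r , c} {.r , c'} refl = cong (r ,_) (T-irrelevant c c')

_≟Ω_ : ∀ {n} → DecidableEquality (Ω⁰ n)
ω ≟Ω ω' with ×-≡-dec (≡-dec _≟ₚ_) (≡-dec _≟ₚ_) (rows ω) (rows ω')
... | yes e = yes (Ω⁰-≡ e)
... | no ne = no λ e → ne (cong rows e)

words : ℕ → List (List Particle)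
words zero    = [] ∷ []
words (suc k) = map (black ∷_) (words k) ++ map (white ∷_) (words k)

∈-words : ∀ xs → xs ∈ words (length xs)
∈-words []           = here refl
∈-words (black ∷ xs) = ∈-++⁺ˡ (∈-map⁺ (black ∷_) (∈-words xs))
∈-words (white ∷ xs) = ∈-++⁺ʳ _ (∈-map⁺ (white ∷_) (∈-words xs))

completeRows : (n : ℕ) → List Rows → List (Ω⁰ n)
completeRows n []       = []
completeRows n (r ∷ rs) with T? (isComplete n r)
... | yes c = (r , c) ∷ completeRows n rs
... | no _  = completeRows n rs

∈-completeRows : ∀ {n} (ω : Ω⁰ n) rs → rows ω ∈ rs → ω ∈ completeRows n rs
∈-completeRows {n} ω (r ∷ rs) r∈ with T? (isComplete n r) | r∈
... | yes c | here refl = here (Ω⁰-≡ refl)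
... | yes c | there r∈' = there (∈-completeRows ω rs r∈')
... | no nc | here refl = contradiction (proj₂ ω) nc
... | no nc | there r∈' = ∈-completeRows ω rs r∈'

∈-Ω⁰-enumeration : ∀ {n} (ω : Ω⁰ n) → ω ∈ completeRows n (cartesianProduct (words n) (words n))
∈-Ω⁰-enumeration {n} ω@((t , b) , c) = ∈-completeRows ω _
  (∈-cartesianProduct⁺ (subst (λ k → t ∈ words k) len-t (∈-words t)) (subst (λ k → b ∈ words k) len-b (∈-words b)))
  where
  len-t = proj₁ (isComplete⇒Complete n (t , b) c)
  len-b = proj₁ (proj₂ (isComplete⇒Complete n (t , b) c))


module _ (n : ℕ) (1≤n : 1 ≤ n) where

  move : (ω : Ω⁰ n) (i : Fin (suc n)) → ∃₂ (Move n (rows ω) (toℕ i))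
  move ω i = classify 1≤n (s≤s⁻¹ (toℕ<n i)) (isComplete⇒Complete n (rows ω) (proj₂ ω))

  T̄ : Ω⁰ n × Fin (suc n) → Ω⁰ n × Fin (suc n)
  T̄ (ω , i) = let r' , j , mv = move ω i in
    (r' , Complete⇒isComplete n r' (Move-complete mv (isComplete⇒Complete n (rows ω) (proj₂ ω)))) , fromℕ< (s≤s (Move-J≤n mv))

  T̄-rows : ∀ ω i → rows (proj₁ (T̄ (ω , i))) ≡ Tmap n ω i
  T̄-rows ω i = sym (Move⇒Traw (proj₂ (proj₂ (move ω i))))

  T̄-injective : Injective _≡_ _≡_ T̄
  T̄-injective {ω , i} {ω' , i'} e =
    cong₂ _,_ (Ω⁰-≡ (cong proj₁ same-input)) (toℕ-injective (cong proj₂ same-input))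
    where
    mv  = proj₂ (proj₂ (move ω i))
    mv' = proj₂ (proj₂ (move ω' i'))
    same-output : proj₁ (move ω i) ≡ proj₁ (move ω' i')
    same-output = cong (λ x → rows (proj₁ x)) e
    same-J : proj₁ (proj₂ (move ω i)) ≡ proj₁ (proj₂ (move ω' i'))
    same-J = trans (sym (toℕ-fromℕ< (s≤s (Move-J≤n mv))))
               (trans (cong (λ x → toℕ (proj₂ x)) e) (toℕ-fromℕ< (s≤s (Move-J≤n mv'))))
    same-input : (rows ω , toℕ i) ≡ (rows ω' , toℕ i')
    same-input = trans (sym (Move⇒Tinv mv)) (trans (cong₂ (Tinv n) same-output same-J) (Move⇒Tinv mv'))

theorem1 : (n : ℕ) → 1 ≤ n →
    Σ ((Ω⁰ n × Fin (suc n)) ⤖ (Ω⁰ n × Fin (suc n))) λ Tbar →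
    ∀ (ω : Ω⁰ n) (i : Fin (suc n)) →
    rows (proj₁ (Bijection.to Tbar (ω , i))) ≡ Tmap n ω i
theorem1 n 1≤n =
  mk⤖ (T̄-injective n 1≤n , injective⇒surjective (×-≡-dec _≟Ω_ _≟ᶠ_) enumerated (T̄-injective n 1≤n)) , T̄-rows n 1≤n
  where
  enumerated : ∀ x → x ∈ cartesianProduct (completeRows n (cartesianProduct (words n) (words n))) (allFin (suc n))
  enumerated (ω , i) = ∈-cartesianProduct⁺ (∈-Ω⁰-enumeration ω) (∈-allFin i)
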